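{- Let $d$ be an odd prime. For a real number $H \ge 1$ and a positive integer $s$, let $\mathcal{G}'_d(s,H)$ denote the set of monic polynomials \[ f(x)=x^d+a_{d-1}x^{d-1}+\dots+a_1x+a_0,\qquad a_0,\dots,a_{d-1}\in\mathbb{Z},\quad \max_{0\le i\le d-1}|a_i|\le H, \] satisfying all of the following: (1) $s\mid a_i$ for $i=0,\dots,d-1$; (2) $\gcd(a_0/s,\,s)=1$; (3) $f$ is Eisenstein at $d$, i.e. $d\mid a_i$ for all $0\le i\le d-1$ and $d^2\nmid a_0$; (4) $a_1\equiv a_2\equiv\dots\equiv a_{d-2}\equiv a_0+a_{d-1}\equiv 0 \pmod{d^2}$. Then for all positive integers $s\le H$ with $\gcd(s,d)=1$, \[ \#\mathcal{G}'_d(s,H)=\frac{2^{d}H^{d}\varphi(ds)}{s^{d+1}d^{2d}}+O\!\left(\frac{H^{d-1}\,2^{\omega(s)}}{s^{d-1}}\right), \] where the implied constant depends only on $d$.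
   Context: $\varphi$ denotes Euler's totient function and $\omega(s)$ denotes the number of distinct prime factors of $s$. The height of a monic integer polynomial is the maximum absolute value of its coefficients.
   Formalization: The height bound H ranges over the rationals H ≥ 1 rather than over all real numbers H ≥ 1. -}

module Defs where

open import Data.Nat as ℕ using (ℕ; zero; suc; NonZero)
open import Data.Nat.Coprimality using (Coprime; coprime?)
open import Data.Nat.Primality using (Prime; prime?)
import Data.Nat.Divisibility as ℕD
open import Data.Integer as ℤ using (ℤ; +_)
open import Data.Integer.Divisibility.Signed using (_∣_; _∣?_)
open import Data.Integer.DivMod using (_/_)
open import Data.Integer.GCD using (gcd)
import Data.Integer.Properties as ℤP
open import Data.Rational as ℚ using (ℚ; 0ℚ; 1ℚ)
import Data.Rational.Properties as ℚP
open import Data.Fin using (Fin; toℕ)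
open import Data.Fin.Properties using (all?)
open import Data.Vec using (Vec; []; _∷_; lookup)
open import Data.List using (List; []; _∷_; [_]; map; concatMap; upTo; length; filter)
open import Data.Product using (_×_)
open import Relation.Nullary using (¬_; Dec)
open import Relation.Nullary.Decidable using (_×-dec_; _→-dec_; ¬?)
open import Relation.Binary.PropositionalEquality using (_≡_)

ℤtoℚ : ℤ → ℚ
ℤtoℚ z = z ℚ./ 1

ℕtoℚ : ℕ → ℚ
ℕtoℚ n = ℤtoℚ (+ n)

_^ℚ_ : ℚ → ℕ → ℚ
q ^ℚ zero  = 1ℚ
q ^ℚ suc n = q ℚ.* (q ^ℚ n)

-- division of a rational by a natural number (junk value 0 when n = 0;
-- only ever used with positive denominators)
_÷ℕ_ : ℚ → ℕ → ℚ
q ÷ℕ zero    = 0ℚ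
q ÷ℕ (suc n) = q ℚ.* ((+ 1) ℚ./ suc n)

φ : ℕ → ℕ
φ n = length (filter (λ k → coprime? k n) (map suc (upTo n)))

-- ω n = #{ p ≤ n : p prime, p ∣ n }   (for n ≥ 1 every prime divisor is ≤ n)
ω : ℕ → ℕ
ω n = length (filter (λ p → prime? p ×-dec (p ℕD.∣? n)) (upTo (suc n)))

-- Coefficient vectors.  A monic polynomial
--   f = x^d + a_{d-1} x^{d-1} + ... + a_0
-- is represented by its vector of lower coefficients a : Vec ℤ d,
-- with a_i = lookup a i  (i : Fin d).

-- a_i for a natural-number index i (0 outside the range; only used for i < d)
coeff : ∀ {n} → Vec ℤ n → ℕ → ℤ
coeff []      _       = + 0
coeff (x ∷ v) zero    = x
coeff (x ∷ v) (suc i) = coeff v i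

HeightLE : ∀ {n} → ℚ → Vec ℤ n → Set
HeightLE {n} H a = (i : Fin n) → ℕtoℚ ℤ.∣ lookup a i ∣ ℚ.≤ H

heightLE? : ∀ {n} (H : ℚ) (a : Vec ℤ n) → Dec (HeightLE H a)
heightLE? H a = all? (λ i → ℕtoℚ ℤ.∣ lookup a i ∣ ℚ.≤? H)

InG' : (d s : ℕ) .{{_ : NonZero s}} → ℚ → Vec ℤ d → Set
InG' d s H a =
    HeightLE H a
  × ((i : Fin d) → (+ s) ∣ lookup a i)
  × (gcd (coeff a 0 / (+ s)) (+ s) ≡ + 1)
  × ((i : Fin d) → (+ d) ∣ lookup a i)
  × (¬ ((+ (d ℕ.* d)) ∣ coeff a 0))
  × ((i : Fin d) → 1 ℕ.≤ toℕ i → toℕ i ℕ.≤ d ℕ.∸ 2 → (+ (d ℕ.* d)) ∣ lookup a i)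
  × ((+ (d ℕ.* d)) ∣ (coeff a 0 ℤ.+ coeff a (d ℕ.∸ 1)))

inG'? : (d s : ℕ) .{{_ : NonZero s}} (H : ℚ) (a : Vec ℤ d) → Dec (InG' d s H a)
inG'? d s H a =
      heightLE? H a
  ×-dec all? (λ i → (+ s) ∣? lookup a i)
  ×-dec (gcd (coeff a 0 / (+ s)) (+ s) ℤP.≟ + 1)
  ×-dec all? (λ i → (+ d) ∣? lookup a i)
  ×-dec ¬? ((+ (d ℕ.* d)) ∣? coeff a 0)
  ×-dec all? (λ i → (1 ℕ.≤? toℕ i) →-dec ((toℕ i ℕ.≤? d ℕ.∸ 2) →-dec ((+ (d ℕ.* d)) ∣? lookup a i)))
  ×-dec ((+ (d ℕ.* d)) ∣? (coeff a 0 ℤ.+ coeff a (d ℕ.∸ 1)))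

intsUpTo : ℕ → List ℤ
intsUpTo B = map (λ k → (+ k) ℤ.- (+ B)) (upTo (suc (2 ℕ.* B)))

vecsOf : ∀ {A : Set} (n : ℕ) → List A → List (Vec A n)
vecsOf zero    xs = [ [] ]
vecsOf (suc n) xs = concatMap (λ x → map (x ∷_) (vecsOf n xs)) xs

-- all coefficient vectors with entries in [-⌈H⌉, ⌈H⌉] (a superset of the
-- vectors of height ≤ H); the height condition itself is part of InG'.
box : (d : ℕ) → ℚ → List (Vec ℤ d)
box d H = vecsOf d (intsUpTo ℤ.∣ ℚ.ceiling H ∣)

countG' : (d s : ℕ) .{{_ : NonZero s}} → ℚ → ℕ
countG' d s H = length (filter (inG'? d s H) (box d H))

mainTerm : ℕ → ℕ → ℚ → ℚ
mainTerm d s H =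
  (ℕtoℚ (2 ℕ.^ d) ℚ.* (H ^ℚ d) ℚ.* ℕtoℚ (φ (d ℕ.* s)))
    ÷ℕ (s ℕ.^ (d ℕ.+ 1) ℕ.* d ℕ.^ (2 ℕ.* d))

errorTerm : ℕ → ℕ → ℚ → ℚ
errorTerm d s H = ((H ^ℚ (d ℕ.∸ 1)) ℚ.* ℕtoℚ (2 ℕ.^ ω s)) ÷ℕ (s ℕ.^ (d ℕ.∸ 1))

module Submission where

open import Defs
open import Data.Nat as ℕ using (ℕ; suc; NonZero)
open import Data.Nat.Divisibility using (_∣_; ∣-refl)
open import Data.Nat.Primality using (Prime; ¬prime[0]; ¬prime[1])
open import Data.Nat.Coprimality using (Coprime)
open import Data.Rational as ℚ using (ℚ; 1ℚ)
open import Data.Product using (∃-syntax; _,_)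
open import Relation.Nullary using (¬_; contradiction)

-- The conditions defining G'_d(s,H) constrain the coefficients separately, except that
-- d² ∣ a₀ + a_{d-1} couples the first and the last one.  With K = ⌊H⌋ and X = ⌊K/s⌋ the
-- count therefore factorises exactly as A^{d-2} · S: every middle coefficient runs over the
-- multiples of d²s in [-K, K] (A ≈ 2X/d² of them), and S sums, over the admissible
-- a₀ = c s, the number of multiples a_{d-1} of ds with a_{d-1} ≡ -a₀ (mod d²), again
-- 2X/d² up to an error 2.  The admissible c are those with d ∣ c, d² ∤ c and gcd(c, s) = 1;
-- sieving out the prime divisors of s one at a time, their number in [1, X] is
-- X φ(ds)/(d² s) up to 3 · 2^{ω(s)}.  Multiplying the approximations yields the main term
-- with an error of at most a constant times (H/s)^{d-1} 2^{ω(s)}.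


module FiniteSums where

  open import Data.Nat as ℕ using (ℕ; zero; suc; NonZero)
  import Data.Nat.Properties as ℕP
  open import Data.List using (List; []; _∷_; map; concatMap; applyUpTo; length; filter; _++_)
  open import Data.Product using (_,_)
  open import Function using (_∘_)
  open import Relation.Nullary using (¬_; Dec; yes; no; contradiction)
  open import Relation.Nullary.Decidable using (_×-dec_; ¬?)
  open import Relation.Binary.PropositionalEquality
  open import Data.Nat.Divisibility as ND using (_∣?_)
  open import Data.Nat.DivMod as DM using (_/_; _%_)
  import Algebra.Properties.CommutativeSemigroup ℕP.+-commutativeSemigroup as +-CS

  𝟙 : ∀ {a} {P : Set a} → Dec P → ℕ
  𝟙 (yes _) = 1
  𝟙 (no _) = 0


  𝟙-yes : ∀ {a} {P : Set a} (p : Dec P) → P → 𝟙 p ≡ 1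
  𝟙-yes (yes _) _ = refl
  𝟙-yes (no ¬p) p = contradiction p ¬p

  𝟙-no : ∀ {a} {P : Set a} (p : Dec P) → ¬ P → 𝟙 p ≡ 0
  𝟙-no (yes p) ¬p = contradiction p ¬p
  𝟙-no (no _) _ = refl

  𝟙≡1⇒ : ∀ {a} {P : Set a} (p : Dec P) → 𝟙 p ≡ 1 → P
  𝟙≡1⇒ (yes p) _ = p
  𝟙≡1⇒ (no _) ()

  𝟙-cong : ∀ {a b} {P : Set a} {Q : Set b} (p : Dec P) (q : Dec Q) → (P → Q) → (Q → P) → 𝟙 p ≡ 𝟙 q
  𝟙-cong (yes _) (yes _) f g = refl
  𝟙-cong (yes p) (no ¬q) f g = contradiction (f p) ¬q
  𝟙-cong (no ¬p) (yes q) f g = contradiction (g q) ¬p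
  𝟙-cong (no _) (no _) f g = refl

  𝟙-× : ∀ {a b} {P : Set a} {Q : Set b} (p : Dec P) (q : Dec Q) → 𝟙 (p ×-dec q) ≡ 𝟙 p ℕ.* 𝟙 q
  𝟙-× (yes _) (yes _) = refl
  𝟙-× (yes _) (no _) = refl
  𝟙-× (no _) (yes _) = refl
  𝟙-× (no _) (no _) = refl

  𝟙-×₇ : ∀ {P1 P2 P3 P4 P5 P6 P7 : Set} (d1 : Dec P1) (d2 : Dec P2) (d3 : Dec P3) (d4 : Dec P4) (d5 : Dec P5) (d6 : Dec P6) (d7 : Dec P7) →
    𝟙 (d1 ×-dec (d2 ×-dec (d3 ×-dec (d4 ×-dec (d5 ×-dec (d6 ×-dec d7)))))) ≡ 𝟙 d1 ℕ.* (𝟙 d2 ℕ.* (𝟙 d3 ℕ.* (𝟙 d4 ℕ.* (𝟙 d5 ℕ.* (𝟙 d6 ℕ.* 𝟙 d7)))))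
  𝟙-×₇ d1 d2 d3 d4 d5 d6 d7 =
    trans (𝟙-× d1 _) (cong (𝟙 d1 ℕ.*_) (trans (𝟙-× d2 _) (cong (𝟙 d2 ℕ.*_) (trans (𝟙-× d3 _) (cong (𝟙 d3 ℕ.*_)
      (trans (𝟙-× d4 _) (cong (𝟙 d4 ℕ.*_) (trans (𝟙-× d5 _) (cong (𝟙 d5 ℕ.*_) (𝟙-× d6 d7))))))))))

  𝟙-¬+𝟙 : ∀ {a} {P : Set a} (x : ℕ) (dp : Dec P) → 𝟙 (¬? dp) ℕ.* x ℕ.+ 𝟙 dp ℕ.* x ≡ x
  𝟙-¬+𝟙 x (yes _) = ℕP.*-identityˡ x
  𝟙-¬+𝟙 x (no _) = trans (ℕP.+-identityʳ _) (ℕP.*-identityˡ x)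

  sumList : ∀ {A : Set} → (A → ℕ) → List A → ℕ
  sumList h [] = 0
  sumList h (x ∷ xs) = h x ℕ.+ sumList h xs

  length-filter≡sumList : ∀ {A : Set} {P : A → Set} (P? : ∀ x → Dec (P x)) (xs : List A) →
    length (filter P? xs) ≡ sumList (λ x → 𝟙 (P? x)) xs
  length-filter≡sumList P? [] = refl
  length-filter≡sumList P? (x ∷ xs) with P? x
  ... | yes _ = cong suc (length-filter≡sumList P? xs)
  ... | no _ = length-filter≡sumList P? xs

  sumList-cong : ∀ {A : Set} {f g : A → ℕ} (xs : List A) → (∀ x → f x ≡ g x) → sumList f xs ≡ sumList g xs
  sumList-cong [] e = refl
  sumList-cong (x ∷ xs) e = cong₂ ℕ._+_ (e x) (sumList-cong xs e)

  sumList-++ : ∀ {A : Set} (f : A → ℕ) (xs ys : List A) → sumList f (xs ++ ys) ≡ sumList f xs ℕ.+ sumList f ys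
  sumList-++ f [] ys = refl
  sumList-++ f (x ∷ xs) ys = trans (cong (f x ℕ.+_) (sumList-++ f xs ys)) (sym (ℕP.+-assoc (f x) _ _))

  sumList-map : ∀ {A B : Set} (f : B → ℕ) (g : A → B) (xs : List A) → sumList f (map g xs) ≡ sumList (f ∘ g) xs
  sumList-map f g [] = refl
  sumList-map f g (x ∷ xs) = cong (f (g x) ℕ.+_) (sumList-map f g xs)

  sumList-concatMap : ∀ {A B : Set} (f : B → ℕ) (g : A → List B) (xs : List A) →
    sumList f (concatMap g xs) ≡ sumList (λ x → sumList f (g x)) xs
  sumList-concatMap f g [] = refl
  sumList-concatMap f g (x ∷ xs) = trans (sumList-++ f (g x) (concatMap g xs)) (cong (sumList f (g x) ℕ.+_) (sumList-concatMap f g xs))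

  sumList-*ˡ : ∀ {A : Set} (c : ℕ) (f : A → ℕ) (xs : List A) → sumList (λ x → c ℕ.* f x) xs ≡ c ℕ.* sumList f xs
  sumList-*ˡ c f [] = sym (ℕP.*-zeroʳ c)
  sumList-*ˡ c f (x ∷ xs) = trans (cong (c ℕ.* f x ℕ.+_) (sumList-*ˡ c f xs)) (sym (ℕP.*-distribˡ-+ c (f x) _))

  sumList-*ʳ : ∀ {A : Set} (c : ℕ) (f : A → ℕ) (xs : List A) → sumList (λ x → f x ℕ.* c) xs ≡ sumList f xs ℕ.* c
  sumList-*ʳ c f xs = trans (sumList-cong xs (λ x → ℕP.*-comm (f x) c)) (trans (sumList-*ˡ c f xs) (ℕP.*-comm c _))

  sumList-mono : ∀ {A : Set} {f g : A → ℕ} (xs : List A) → (∀ x → f x ℕ.≤ g x) → sumList f xs ℕ.≤ sumList g xs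
  sumList-mono [] h = ℕ.z≤n
  sumList-mono (x ∷ xs) h = ℕP.+-mono-≤ (h x) (sumList-mono xs h)

  sumList-+ : ∀ {A : Set} (f g : A → ℕ) (xs : List A) → sumList (λ x → f x ℕ.+ g x) xs ≡ sumList f xs ℕ.+ sumList g xs
  sumList-+ f g [] = refl
  sumList-+ f g (x ∷ xs) = trans (cong (f x ℕ.+ g x ℕ.+_) (sumList-+ f g xs)) (+-CS.interchange (f x) (g x) (sumList f xs) (sumList g xs))

  sumBelow : (ℕ → ℕ) → ℕ → ℕ
  sumBelow h zero = 0
  sumBelow h (suc n) = h 0 ℕ.+ sumBelow (h ∘ suc) n

  sumList-applyUpTo : ∀ {A : Set} (f : A → ℕ) (g : ℕ → A) n → sumList f (applyUpTo g n) ≡ sumBelow (f ∘ g) n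
  sumList-applyUpTo f g zero = refl
  sumList-applyUpTo f g (suc n) = cong (f (g 0) ℕ.+_) (sumList-applyUpTo f (g ∘ suc) n)

  sumBelow-cong : ∀ {f g : ℕ → ℕ} n → (∀ k → k ℕ.< n → f k ≡ g k) → sumBelow f n ≡ sumBelow g n
  sumBelow-cong zero e = refl
  sumBelow-cong (suc n) e = cong₂ ℕ._+_ (e 0 (ℕ.s≤s ℕ.z≤n)) (sumBelow-cong n (λ k k<n → e (suc k) (ℕ.s≤s k<n)))

  sumBelow-split : ∀ (f : ℕ → ℕ) m n → sumBelow f (m ℕ.+ n) ≡ sumBelow f m ℕ.+ sumBelow (λ k → f (m ℕ.+ k)) n
  sumBelow-split f zero n = refl
  sumBelow-split f (suc m) n = trans (cong (f 0 ℕ.+_) (sumBelow-split (f ∘ suc) m n)) (sym (ℕP.+-assoc (f 0) _ _))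

  sumBelow-snoc : ∀ (f : ℕ → ℕ) n → sumBelow f (suc n) ≡ sumBelow f n ℕ.+ f n
  sumBelow-snoc f n = trans (cong (sumBelow f) (ℕP.+-comm 1 n)) (trans (sumBelow-split f n 1) (cong (sumBelow f n ℕ.+_) (trans (ℕP.+-identityʳ _) (cong f (ℕP.+-identityʳ n)))))

  sumBelow-+ : ∀ (f g : ℕ → ℕ) n → sumBelow (λ k → f k ℕ.+ g k) n ≡ sumBelow f n ℕ.+ sumBelow g n
  sumBelow-+ f g zero = refl
  sumBelow-+ f g (suc n) rewrite sumBelow-+ (f ∘ suc) (g ∘ suc) n = +-CS.interchange (f 0) (g 0) _ _

  sumBelow-zero : ∀ (f : ℕ → ℕ) n → (∀ k → k ℕ.< n → f k ≡ 0) → sumBelow f n ≡ 0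
  sumBelow-zero f zero e = refl
  sumBelow-zero f (suc n) e rewrite e 0 (ℕ.s≤s ℕ.z≤n) = sumBelow-zero (f ∘ suc) n (λ k k<n → e (suc k) (ℕ.s≤s k<n))


  sumBelow-const : ∀ c n → sumBelow (λ _ → c) n ≡ n ℕ.* c
  sumBelow-const c zero = refl
  sumBelow-const c (suc n) = cong (c ℕ.+_) (sumBelow-const c n)

  sumBelow-prefix : ∀ (f : ℕ → ℕ) m n → m ℕ.≤ n → sumBelow f m ℕ.≤ sumBelow f n
  sumBelow-prefix f m n m≤n with ℕP.m≤n⇒∃[o]m+o≡n m≤n
  ... | o , refl = ℕP.≤-trans (ℕP.m≤m+n (sumBelow f m) _) (ℕP.≤-reflexive (sym (sumBelow-split f m o)))

  sumTo : (ℕ → ℕ) → ℕ → ℕ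
  sumTo f n = sumBelow (f ∘ suc) n

  sumTo-cong : ∀ {f g : ℕ → ℕ} n → (∀ k → f k ≡ g k) → sumTo f n ≡ sumTo g n
  sumTo-cong n e = sumBelow-cong n (λ k _ → e (suc k))

  ∤-between-multiples : ∀ p m j → 0 ℕ.< j → j ℕ.< p → ¬ (p ND.∣ m ℕ.* p ℕ.+ j)
  ∤-between-multiples p m j 0<j j<p d = ℕP.<⇒≱ j<p (ND.∣⇒≤ {{ℕ.>-nonZero 0<j}} (ND.∣m+n∣m⇒∣n d (ND.n∣m*n m)))

  module Multiples (p : ℕ) .{{_ : NonZero p}} (f : ℕ → ℕ) where
    g : ℕ → ℕ
    g b = 𝟙 (p ∣? b) ℕ.* f b

    sumBelow-between-multiples : ∀ m r → r ℕ.< p → sumBelow (λ k → g (suc (m ℕ.* p ℕ.+ k))) r ≡ 0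
    sumBelow-between-multiples m r r<p = sumBelow-zero _ r λ k k<r → trans (cong g (sym (ℕP.+-suc (m ℕ.* p) k)))
       (cong (ℕ._* f (m ℕ.* p ℕ.+ suc k)) (𝟙-no (p ∣? _) (∤-between-multiples p m (suc k) (ℕ.s≤s ℕ.z≤n) (ℕP.<-≤-trans (ℕ.s≤s k<r) r<p))))

    sumTo-whole-blocks : ∀ m → sumTo g (m ℕ.* p) ≡ sumTo (f ∘ (p ℕ.*_)) m
    sumTo-whole-blocks zero = refl
    sumTo-whole-blocks (suc m) = begin
        sumTo g (suc m ℕ.* p)
      ≡⟨ cong (sumTo g) (ℕP.+-comm p (m ℕ.* p)) ⟩
        sumTo g (m ℕ.* p ℕ.+ p)
      ≡⟨ sumBelow-split (g ∘ suc) (m ℕ.* p) p ⟩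
        sumTo g (m ℕ.* p) ℕ.+ sumBelow (λ k → g (suc (m ℕ.* p ℕ.+ k))) p
      ≡⟨ cong₂ ℕ._+_ (sumTo-whole-blocks m) lastblock ⟩
        sumTo (f ∘ (p ℕ.*_)) m ℕ.+ f (p ℕ.* suc m)
      ≡⟨ sym (sumBelow-snoc (f ∘ (p ℕ.*_) ∘ suc) m) ⟩
        sumTo (f ∘ (p ℕ.*_)) (suc m)
      ∎
      where
      open ≡-Reasoning
      p' = p ℕ.∸ 1
      p≡ : p ≡ suc p'
      p≡ = sym (ℕP.suc-pred p)
      eqlast : suc (m ℕ.* p ℕ.+ p') ≡ p ℕ.* suc m
      eqlast = begin
          suc (m ℕ.* p ℕ.+ p') ≡⟨ sym (ℕP.+-suc (m ℕ.* p) p') ⟩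
          m ℕ.* p ℕ.+ suc p' ≡⟨ cong (m ℕ.* p ℕ.+_) (sym p≡) ⟩
          m ℕ.* p ℕ.+ p ≡⟨ ℕP.+-comm (m ℕ.* p) p ⟩
          suc m ℕ.* p ≡⟨ ℕP.*-comm (suc m) p ⟩
          p ℕ.* suc m ∎
      lastblock : sumBelow (λ k → g (suc (m ℕ.* p ℕ.+ k))) p ≡ f (p ℕ.* suc m)
      lastblock = begin
          sumBelow (λ k → g (suc (m ℕ.* p ℕ.+ k))) p
        ≡⟨ cong (sumBelow (λ k → g (suc (m ℕ.* p ℕ.+ k)))) p≡ ⟩
          sumBelow (λ k → g (suc (m ℕ.* p ℕ.+ k))) (suc p')
        ≡⟨ sumBelow-snoc _ p' ⟩
          sumBelow (λ k → g (suc (m ℕ.* p ℕ.+ k))) p' ℕ.+ g (suc (m ℕ.* p ℕ.+ p'))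
        ≡⟨ cong₂ ℕ._+_ (sumBelow-between-multiples m p' (ℕP.≤-reflexive (sym p≡))) (cong g eqlast) ⟩
          g (p ℕ.* suc m)
        ≡⟨ cong (ℕ._* f (p ℕ.* suc m)) (𝟙-yes (p ∣? _) (ND.m∣m*n (suc m))) ⟩
          f (p ℕ.* suc m) ℕ.+ 0
        ≡⟨ ℕP.+-identityʳ _ ⟩
          f (p ℕ.* suc m) ∎

    sumTo-blocks+remainder : ∀ m r → r ℕ.< p → sumTo g (m ℕ.* p ℕ.+ r) ≡ sumTo (f ∘ (p ℕ.*_)) m
    sumTo-blocks+remainder m r r<p = trans (sumBelow-split (g ∘ suc) (m ℕ.* p) r) (trans (cong₂ ℕ._+_ (sumTo-whole-blocks m) (sumBelow-between-multiples m r r<p)) (ℕP.+-identityʳ _))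

    sumTo-multiples : ∀ n → sumTo g n ≡ sumTo (f ∘ (p ℕ.*_)) (n / p)
    sumTo-multiples n = trans (cong (sumTo g) (trans (DM.m≡m%n+[m/n]*n n p) (ℕP.+-comm (n % p) _))) (sumTo-blocks+remainder (n / p) (n % p) (DM.m%n<n n p))

  sumTo-multiples : ∀ p .{{_ : NonZero p}} (f : ℕ → ℕ) n → sumTo (λ b → 𝟙 (p ∣? b) ℕ.* f b) n ≡ sumTo (λ c → f (p ℕ.* c)) (n / p)
  sumTo-multiples p f n = Multiples.sumTo-multiples p f n

  sumTo-𝟙∣ : ∀ p .{{_ : NonZero p}} n → sumTo (λ b → 𝟙 (p ∣? b)) n ≡ n / p
  sumTo-𝟙∣ p n = trans (sumTo-cong {λ b → 𝟙 (p ∣? b)} n (λ k → sym (ℕP.*-identityʳ (𝟙 (p ∣? k))))) (trans (sumTo-multiples p (λ _ → 1) n) (trans (sumBelow-const 1 (n / p)) (ℕP.*-identityʳ _)))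

  sumTo-periodic : ∀ (f : ℕ → ℕ) T → (∀ b → f (T ℕ.+ b) ≡ f b) → ∀ k → sumTo f (k ℕ.* T) ≡ k ℕ.* sumTo f T
  sumTo-periodic f T f-periodic zero = refl
  sumTo-periodic f T f-periodic (suc k) = trans (sumBelow-split (f ∘ suc) T (k ℕ.* T)) (cong (sumTo f T ℕ.+_)
    (trans (sumBelow-cong (k ℕ.* T) (λ b _ → trans (cong f (sym (ℕP.+-suc T b))) (f-periodic (suc b)))) (sumTo-periodic f T f-periodic k)))

  sumTo-truncate : ∀ (g c : ℕ → ℕ) K B → K ℕ.≤ B → (∀ b → b ℕ.≤ K → c b ≡ g b) → (∀ b → K ℕ.< b → c b ≡ 0) → sumTo c B ≡ sumTo g K
  sumTo-truncate g c K B K≤B e1 e0 with ℕP.m≤n⇒∃[o]m+o≡n K≤B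
  ... | o , refl = trans (sumBelow-split (c ∘ suc) K o) (trans (cong₂ ℕ._+_
        (sumBelow-cong K (λ k k<K → e1 (suc k) k<K))
        (sumBelow-zero _ o (λ k _ → e0 (suc (K ℕ.+ k)) (ℕ.s≤s (ℕP.m≤m+n K k))))) (ℕP.+-identityʳ _))


module RationalLemmas where

  open import Defs
  open import Data.Nat as ℕ using (ℕ; zero; suc; NonZero)
  import Data.Nat.Properties as ℕP
  open import Data.Nat.Divisibility using (divides; _∣_)
  open import Data.Nat.DivMod as DM using (_/_; _%_)
  import Data.Nat.Coprimality as NC
  open import Data.Integer as ℤ using (ℤ; +_; -[1+_])
  import Data.Integer.Properties as ℤP
  open import Data.Rational as ℚ using (ℚ; 0ℚ; 1ℚ; mkℚ; _+_; _*_; _-_; -_; _≤_; ∣_∣)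
  import Data.Rational.Properties as ℚP
  open import Data.Rational.Solver using (module +-*-Solver)
  open import Data.Sum using (inj₁; inj₂)
  open import Data.Product using (_×_; _,_)
  open import Relation.Binary.PropositionalEquality
  open +-*-Solver

  ℤtoℚ≡mkℚ : ∀ z → ℤtoℚ z ≡ mkℚ z 0 (NC.sym (NC.1-coprimeTo ℤ.∣ z ∣))
  ℤtoℚ≡mkℚ (+ n) = ℚP.normalize-coprime (NC.sym (NC.1-coprimeTo n))
  ℤtoℚ≡mkℚ -[1+ n ] = cong ℚ.-_ (ℚP.normalize-coprime (NC.sym (NC.1-coprimeTo (suc n))))

  ℤtoℚ-+ : ∀ a b → ℤtoℚ (a ℤ.+ b) ≡ ℤtoℚ a ℚ.+ ℤtoℚ b
  ℤtoℚ-+ a b rewrite ℤtoℚ≡mkℚ a | ℤtoℚ≡mkℚ b = cong (λ z → z ℚ./ 1) (sym (cong₂ ℤ._+_ (ℤP.*-identityʳ a) (ℤP.*-identityʳ b)))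

  ℤtoℚ-* : ∀ a b → ℤtoℚ (a ℤ.* b) ≡ ℤtoℚ a ℚ.* ℤtoℚ b
  ℤtoℚ-* a b rewrite ℤtoℚ≡mkℚ a | ℤtoℚ≡mkℚ b = refl

  ℤtoℚ-mono : ∀ {a b} → a ℤ.≤ b → ℤtoℚ a ℚ.≤ ℤtoℚ b
  ℤtoℚ-mono {a} {b} le rewrite ℤtoℚ≡mkℚ a | ℤtoℚ≡mkℚ b = ℚ.*≤* (subst₂ ℤ._≤_ (sym (ℤP.*-identityʳ a)) (sym (ℤP.*-identityʳ b)) le)

  ℕtoℚ-+ : ∀ m n → ℕtoℚ (m ℕ.+ n) ≡ ℕtoℚ m ℚ.+ ℕtoℚ n
  ℕtoℚ-+ m n = trans (cong ℤtoℚ (ℤP.pos-+ m n)) (ℤtoℚ-+ (+ m) (+ n))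

  ℕtoℚ-* : ∀ m n → ℕtoℚ (m ℕ.* n) ≡ ℕtoℚ m ℚ.* ℕtoℚ n
  ℕtoℚ-* m n = trans (cong ℤtoℚ (ℤP.pos-* m n)) (ℤtoℚ-* (+ m) (+ n))

  ℕtoℚ-mono : ∀ {m n} → m ℕ.≤ n → ℕtoℚ m ℚ.≤ ℕtoℚ n
  ℕtoℚ-mono le = ℤtoℚ-mono (ℤ.+≤+ le)

  ℕtoℚ-nonneg : ∀ n → 0ℚ ≤ ℕtoℚ n
  ℕtoℚ-nonneg n = ℕtoℚ-mono {0} {n} ℕ.z≤n

  ℕtoℚ-∸ : ∀ a b c → a ℕ.+ b ≡ c → ℕtoℚ a ≡ ℕtoℚ c - ℕtoℚ b
  ℕtoℚ-∸ a b c e = trans (solve 2 (λ a b → a := a :+ b :- b) refl (ℕtoℚ a) (ℕtoℚ b)) (cong (_- ℕtoℚ b) (trans (sym (ℕtoℚ-+ a b)) (cong ℕtoℚ e)))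

  ℕtoℚ-^ : ∀ n k → ℕtoℚ (n ℕ.^ k) ≡ ℕtoℚ n ^ℚ k
  ℕtoℚ-^ n zero = refl
  ℕtoℚ-^ n (suc k) = trans (ℕtoℚ-* n (n ℕ.^ k)) (cong (ℕtoℚ n *_) (ℕtoℚ-^ n k))

  ≤⇒0≤- : ∀ {x y} → x ≤ y → 0ℚ ≤ y - x
  ≤⇒0≤- {x} {y} le = subst (_≤ y - x) (ℚP.+-inverseʳ x) (ℚP.+-monoˡ-≤ (- x) le)

  0≤-⇒≤ : ∀ {x y} → 0ℚ ≤ y - x → x ≤ y
  0≤-⇒≤ {x} {y} le = subst₂ _≤_ (ℚP.+-identityˡ x) e (ℚP.+-monoˡ-≤ x le)
    where
    e : y - x + x ≡ y
    e = solve 2 (λ x y → y :- x :+ x := y) refl x y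

  0≤* : ∀ {a b} → 0ℚ ≤ a → 0ℚ ≤ b → 0ℚ ≤ a * b
  0≤* {a} {b} 0≤a 0≤b = ℚP.nonNegative⁻¹ _ {{ℚP.nonNeg*nonNeg⇒nonNeg a {{ℚ.nonNegative 0≤a}} b {{ℚ.nonNegative 0≤b}}}}

  0≤+ : ∀ {a b} → 0ℚ ≤ a → 0ℚ ≤ b → 0ℚ ≤ a + b
  0≤+ {a} {b} 0≤a 0≤b = ℚP.+-mono-≤ 0≤a 0≤b

  *-monoˡ : ∀ {a b} c → 0ℚ ≤ c → a ≤ b → c * a ≤ c * b
  *-monoˡ c 0≤c le = ℚP.*-monoˡ-≤-nonNeg c {{ℚ.nonNegative 0≤c}} le

  *-monoʳ : ∀ {a b} c → 0ℚ ≤ c → a ≤ b → a * c ≤ b * c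
  *-monoʳ c 0≤c le = ℚP.*-monoʳ-≤-nonNeg c {{ℚ.nonNegative 0≤c}} le

  *-mono : ∀ {a b c e} → 0ℚ ≤ a → 0ℚ ≤ c → a ≤ b → c ≤ e → a * c ≤ b * e
  *-mono {a} {b} {c} {e} 0≤a 0≤c a≤b c≤e = ℚP.≤-trans (*-monoˡ a 0≤a c≤e) (*-monoʳ e (ℚP.≤-trans 0≤c c≤e) a≤b)

  1≤⇒0≤ : ∀ {M} → 1ℚ ≤ M → 0ℚ ≤ M
  1≤⇒0≤ h = ℚP.≤-trans (ℚP.<⇒≤ (ℚP.positive⁻¹ 1ℚ)) h

  1≤⇒positive : ∀ {M} → 1ℚ ≤ M → ℚ.Positive M
  1≤⇒positive h = ℚ.positive (ℚP.<-≤-trans (ℚP.positive⁻¹ 1ℚ) h)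

  neg-involutive : ∀ x → - (- x) ≡ x
  neg-involutive = solve 1 (λ x → :- (:- x) := x) refl

  ∣∣≤-intro : ∀ {x e} → - e ≤ x → x ≤ e → ∣ x ∣ ≤ e
  ∣∣≤-intro {x} {e} l u with ℚP.∣p∣≡p∨∣p∣≡-p x
  ... | inj₁ eq = subst (_≤ e) (sym eq) u
  ... | inj₂ eq = subst (_≤ e) (sym eq) (subst (- x ≤_) (neg-involutive e) (ℚP.neg-antimono-≤ l))

  p≤∣p∣ : ∀ x → x ≤ ∣ x ∣
  p≤∣p∣ x with ℚP.∣p∣≡p∨∣p∣≡-p x
  ... | inj₁ eq = ℚP.≤-reflexive (sym eq)
  ... | inj₂ eq = 0≤-⇒≤ (subst (λ z → 0ℚ ≤ z - x) (sym eq) (0≤+ h h))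
    where
    h : 0ℚ ≤ - x
    h = subst (0ℚ ≤_) eq (ℚP.0≤∣p∣ x)

  ∣∣≤⇒≤ : ∀ {x e} → ∣ x ∣ ≤ e → x ≤ e
  ∣∣≤⇒≤ {x} le = ℚP.≤-trans (p≤∣p∣ x) le

  ∣∣≤⇒-≤ : ∀ {x e} → ∣ x ∣ ≤ e → - e ≤ x
  ∣∣≤⇒-≤ {x} {e} le = subst (- e ≤_) (neg-involutive x) (ℚP.neg-antimono-≤ (ℚP.≤-trans (p≤∣p∣ (- x)) (subst (_≤ e) (sym (ℚP.∣-p∣≡∣p∣ x)) le)))

  ∣-p∣≤ : ∀ {x e} → ∣ x ∣ ≤ e → ∣ - x ∣ ≤ e
  ∣-p∣≤ {x} h = subst (_≤ _) (sym (ℚP.∣-p∣≡∣p∣ x)) h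

  triangle₃ : ∀ a b c {ea eb ec} → ∣ a ∣ ≤ ea → ∣ b ∣ ≤ eb → ∣ c ∣ ≤ ec → ∣ a - b + c ∣ ≤ ea + eb + ec
  triangle₃ a b c ha hb hc = ℚP.≤-trans (ℚP.∣p+q∣≤∣p∣+∣q∣ (a - b) c) (ℚP.+-mono-≤ (ℚP.≤-trans (ℚP.∣p+q∣≤∣p∣+∣q∣ a (- b)) (ℚP.+-mono-≤ ha (subst (_≤ _) (sym (ℚP.∣-p∣≡∣p∣ b)) hb))) hc)

  triangle₂ : ∀ a b {ea eb} → ∣ a ∣ ≤ ea → ∣ b ∣ ≤ eb → ∣ a - b ∣ ≤ ea + eb
  triangle₂ a b ha hb = ℚP.≤-trans (ℚP.∣p+q∣≤∣p∣+∣q∣ a (- b)) (ℚP.+-mono-≤ ha (∣-p∣≤ hb))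

  ∣[0,1]*p∣≤ : ∀ {a x e} → 0ℚ ≤ a → a ≤ 1ℚ → ∣ x ∣ ≤ e → ∣ a * x ∣ ≤ e
  ∣[0,1]*p∣≤ {a} {x} {e} 0≤a a≤1 h = subst (_≤ e) (sym (trans (ℚP.∣p*q∣≡∣p∣*∣q∣ a x) (cong (_* ∣ x ∣) (ℚP.0≤p⇒∣p∣≡p 0≤a))))
    (ℚP.≤-trans (*-monoʳ ∣ x ∣ (ℚP.0≤∣p∣ x) a≤1) (subst (_≤ e) (sym (ℚP.*-identityˡ ∣ x ∣)) h))

  ∣*∣≤ : ∀ {x y X Y} → ∣ x ∣ ≤ X → ∣ y ∣ ≤ Y → ∣ x * y ∣ ≤ X * Y
  ∣*∣≤ {x} {y} hx hy = subst (_≤ _) (sym (ℚP.∣p*q∣≡∣p∣*∣q∣ x y)) (*-mono (ℚP.0≤∣p∣ x) (ℚP.0≤∣p∣ y) hx hy)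

  ∣∣≤+∣∣ : ∀ {a v B} → ∣ a - v ∣ ≤ B → ∣ a ∣ ≤ B + ∣ v ∣
  ∣∣≤+∣∣ {a} {v} {B} h = subst (_≤ B + ∣ v ∣) (cong ∣_∣ (solve 2 (λ a v → (a :- v) :+ v := a) refl a v)) (ℚP.≤-trans (ℚP.∣p+q∣≤∣p∣+∣q∣ (a - v) v) (ℚP.+-monoˡ-≤ ∣ v ∣ h))

  recip : ℕ → ℚ
  recip n = 1ℚ ÷ℕ n

  recip*n≡1 : ∀ n → .{{NonZero n}} → recip n * ℕtoℚ n ≡ 1ℚ
  recip*n≡1 (suc n) = trans (cong (_* ℕtoℚ (suc n)) (ℚP.*-identityˡ ((+ 1) ℚ./ suc n))) (trans (cong₂ _*_ e (ℤtoℚ≡mkℚ (+ suc n))) (ℚP.*-inverseˡ (mkℚ (+ suc n) 0 (NC.sym (NC.1-coprimeTo (suc n))))))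
    where
    e : (+ 1) ℚ./ suc n ≡ ℚ.1/ (mkℚ (+ suc n) 0 (NC.sym (NC.1-coprimeTo (suc n))))
    e = ℚP.normalize-coprime (NC.1-coprimeTo (suc n))

  recip-nonneg : ∀ n → 0ℚ ≤ recip n
  recip-nonneg zero = ℚP.≤-refl
  recip-nonneg (suc n) = subst (0ℚ ≤_) (sym (trans (ℚP.*-identityˡ ((+ 1) ℚ./ suc n)) (ℚP.normalize-coprime (NC.1-coprimeTo (suc n))))) (ℚ.*≤* (ℤ.+≤+ ℕ.z≤n))

  ÷ℕ≡*recip : ∀ x n → x ÷ℕ n ≡ x * recip n
  ÷ℕ≡*recip x zero = sym (ℚP.*-zeroʳ x)
  ÷ℕ≡*recip x (suc n) = cong (x *_) (sym (ℚP.*-identityˡ ((+ 1) ℚ./ suc n)))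

  ≤*n⇒*recip≤ : ∀ {x y} n → .{{NonZero n}} → x ≤ y * ℕtoℚ n → x * recip n ≤ y
  ≤*n⇒*recip≤ {x} {y} n le = subst (x * recip n ≤_) e (*-monoʳ (recip n) (recip-nonneg n) le)
    where
    e : y * ℕtoℚ n * recip n ≡ y
    e = trans (ℚP.*-assoc y _ _) (trans (cong (y *_) (trans (ℚP.*-comm (ℕtoℚ n) (recip n)) (recip*n≡1 n))) (ℚP.*-identityʳ y))

  *n≤⇒≤*recip : ∀ {x y} n → .{{NonZero n}} → y * ℕtoℚ n ≤ x → y ≤ x * recip n
  *n≤⇒≤*recip {x} {y} n le = subst (_≤ x * recip n) e (*-monoʳ (recip n) (recip-nonneg n) le)
    where
    e : y * ℕtoℚ n * recip n ≡ y
    e = trans (ℚP.*-assoc y _ _) (trans (cong (y *_) (trans (ℚP.*-comm (ℕtoℚ n) (recip n)) (recip*n≡1 n))) (ℚP.*-identityʳ y))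

  n*x≡y⇒x≡y*recip : ∀ n .{{_ : NonZero n}} {x y} → ℕtoℚ n * x ≡ y → x ≡ y * recip n
  n*x≡y⇒x≡y*recip n {x} refl = begin
    x ≡⟨ sym (ℚP.*-identityˡ x) ⟩
    1ℚ * x ≡⟨ cong (_* x) (sym (recip*n≡1 n)) ⟩
    recip n * ℕtoℚ n * x ≡⟨ solve 3 (λ r n x → r :* n :* x := n :* x :* r) refl (recip n) (ℕtoℚ n) x ⟩
    ℕtoℚ n * x * recip n ∎
    where open ≡-Reasoning

  *-cancelˡ-ℕtoℚ : ∀ k .{{_ : NonZero k}} {a b} → ℕtoℚ k * a ≡ ℕtoℚ k * b → a ≡ b
  *-cancelˡ-ℕtoℚ k e = trans (n*x≡y⇒x≡y*recip k e) (sym (n*x≡y⇒x≡y*recip k refl))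

  recip≤1 : ∀ n → .{{NonZero n}} → recip n ≤ 1ℚ
  recip≤1 n = subst (_≤ 1ℚ) (ℚP.*-identityˡ (recip n)) (≤*n⇒*recip≤ n (subst (1ℚ ≤_) (sym (ℚP.*-identityˡ (ℕtoℚ n))) (ℕtoℚ-mono {1} {n} (ℕP.n≢0⇒n>0 (ℕ.≢-nonZero⁻¹ n)))))

  recip-unique : ∀ {x y} n → x * ℕtoℚ n ≡ 1ℚ → y * ℕtoℚ n ≡ 1ℚ → x ≡ y
  recip-unique {x} {y} n hx hy = begin
    x ≡⟨ sym (ℚP.*-identityʳ x) ⟩
    x * 1ℚ ≡⟨ cong (x *_) (sym hy) ⟩
    x * (y * ℕtoℚ n) ≡⟨ solve 3 (λ x y n → x :* (y :* n) := y :* (x :* n)) refl x y (ℕtoℚ n) ⟩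
    y * (x * ℕtoℚ n) ≡⟨ cong (y *_) hx ⟩
    y * 1ℚ ≡⟨ ℚP.*-identityʳ y ⟩
    y ∎
    where open ≡-Reasoning

  recip-* : ∀ a b .{{_ : NonZero a}} .{{_ : NonZero b}} → recip (a ℕ.* b) ≡ recip a * recip b
  recip-* a b = recip-unique (a ℕ.* b) (recip*n≡1 (a ℕ.* b) {{ℕP.m*n≢0 a b}}) (begin
    recip a * recip b * ℕtoℚ (a ℕ.* b) ≡⟨ cong (recip a * recip b *_) (ℕtoℚ-* a b) ⟩
    recip a * recip b * (ℕtoℚ a * ℕtoℚ b) ≡⟨ solve 4 (λ x y u v → x :* y :* (u :* v) := (x :* u) :* (y :* v)) refl (recip a) (recip b) (ℕtoℚ a) (ℕtoℚ b) ⟩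
    (recip a * ℕtoℚ a) * (recip b * ℕtoℚ b) ≡⟨ cong₂ _*_ (recip*n≡1 a) (recip*n≡1 b) ⟩
    1ℚ ∎)
    where open ≡-Reasoning

  0≤1-recip≤1 : ∀ p .{{_ : NonZero p}} → 0ℚ ≤ 1ℚ - recip p × 1ℚ - recip p ≤ 1ℚ
  0≤1-recip≤1 p = ≤⇒0≤- (recip≤1 p) , 0≤-⇒≤ (subst (0ℚ ≤_) (solve 1 (λ i → i := con 1ℚ :- (con 1ℚ :- i)) refl (recip p)) (recip-nonneg p))

  ∣n/p-n*recip∣≤1 : ∀ n p .{{_ : NonZero p}} → ∣ ℕtoℚ (n / p) - ℕtoℚ n * recip p ∣ ≤ 1ℚ
  ∣n/p-n*recip∣≤1 n p = subst (λ z → ∣ z ∣ ≤ 1ℚ) (sym eq) (∣-p∣≤ (subst (_≤ 1ℚ) (sym (ℚP.0≤p⇒∣p∣≡p 0≤rι)) rι≤1))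
    where
    r = n % p
    q = n / p
    open ≡-Reasoning
    rι≤1 : ℕtoℚ r * recip p ≤ 1ℚ
    rι≤1 = ℚP.≤-trans (*-monoʳ (recip p) (recip-nonneg p) (ℕtoℚ-mono (ℕP.<⇒≤ (DM.m%n<n n p)))) (ℚP.≤-reflexive (trans (ℚP.*-comm (ℕtoℚ p) (recip p)) (recip*n≡1 p)))
    0≤rι : 0ℚ ≤ ℕtoℚ r * recip p
    0≤rι = 0≤* (ℕtoℚ-nonneg r) (recip-nonneg p)
    eq : ℕtoℚ q - ℕtoℚ n * recip p ≡ - (ℕtoℚ r * recip p)
    eq = begin
      ℕtoℚ q - ℕtoℚ n * recip p ≡⟨ cong (λ z → ℕtoℚ q - ℕtoℚ z * recip p) (DM.m≡m%n+[m/n]*n n p) ⟩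
      ℕtoℚ q - ℕtoℚ (r ℕ.+ q ℕ.* p) * recip p ≡⟨ cong (λ z → ℕtoℚ q - z * recip p) (trans (ℕtoℚ-+ r _) (cong (λ z → ℕtoℚ r + z) (ℕtoℚ-* q p))) ⟩
      ℕtoℚ q - (ℕtoℚ r + ℕtoℚ q * ℕtoℚ p) * recip p ≡⟨ solve 4 (λ Q R P I → Q :- (R :+ Q :* P) :* I := :- (R :* I) :+ Q :* (con 1ℚ :- P :* I)) refl (ℕtoℚ q) (ℕtoℚ r) (ℕtoℚ p) (recip p) ⟩
      - (ℕtoℚ r * recip p) + ℕtoℚ q * (1ℚ - ℕtoℚ p * recip p) ≡⟨ cong (λ z → - (ℕtoℚ r * recip p) + ℕtoℚ q * (1ℚ - z)) (trans (ℚP.*-comm (ℕtoℚ p) (recip p)) (recip*n≡1 p)) ⟩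
      - (ℕtoℚ r * recip p) + ℕtoℚ q * (1ℚ - 1ℚ) ≡⟨ solve 2 (λ a b → a :+ b :* (con 1ℚ :- con 1ℚ) := a) refl (- (ℕtoℚ r * recip p)) (ℕtoℚ q) ⟩
      - (ℕtoℚ r * recip p) ∎

  ℕtoℚ-/-exact : ∀ n p .{{_ : NonZero p}} → p ∣ n → ℕtoℚ (n / p) ≡ ℕtoℚ n * recip p
  ℕtoℚ-/-exact n p (divides q refl) = begin
    ℕtoℚ (q ℕ.* p / p) ≡⟨ cong ℕtoℚ (DM.m*n/n≡m q p) ⟩
    ℕtoℚ q ≡⟨ sym (ℚP.*-identityʳ _) ⟩
    ℕtoℚ q * 1ℚ ≡⟨ cong (ℕtoℚ q *_) (sym (trans (ℚP.*-comm (ℕtoℚ p) (recip p)) (recip*n≡1 p))) ⟩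
    ℕtoℚ q * (ℕtoℚ p * recip p) ≡⟨ sym (ℚP.*-assoc (ℕtoℚ q) (ℕtoℚ p) (recip p)) ⟩
    ℕtoℚ q * ℕtoℚ p * recip p ≡⟨ cong (_* recip p) (sym (ℕtoℚ-* q p)) ⟩
    ℕtoℚ (q ℕ.* p) * recip p ∎
    where open ≡-Reasoning

  0≤^ : ∀ {x} k → 0ℚ ≤ x → 0ℚ ≤ x ^ℚ k
  0≤^ zero h = ℚP.≤-trans (ℚP.<⇒≤ (ℚP.positive⁻¹ 1ℚ)) ℚP.≤-refl
  0≤^ (suc k) h = 0≤* h (0≤^ k h)

  ∣^∣ : ∀ x k → ∣ x ^ℚ k ∣ ≡ ∣ x ∣ ^ℚ k
  ∣^∣ x zero = refl
  ∣^∣ x (suc k) = trans (ℚP.∣p*q∣≡∣p∣*∣q∣ x (x ^ℚ k)) (cong (∣ x ∣ *_) (∣^∣ x k))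

  ^-mono : ∀ {x y} k → 0ℚ ≤ x → x ≤ y → x ^ℚ k ≤ y ^ℚ k
  ^-mono zero _ _ = ℚP.≤-refl
  ^-mono (suc k) 0≤x x≤y = *-mono 0≤x (0≤^ k 0≤x) x≤y (^-mono k 0≤x x≤y)

  ∣^∣≤ : ∀ {x M} k → ∣ x ∣ ≤ M → ∣ x ^ℚ k ∣ ≤ M ^ℚ k
  ∣^∣≤ {x} k h = subst (_≤ _) (sym (∣^∣ x k)) (^-mono k (ℚP.0≤∣p∣ x) h)

  *-^ : ∀ x y k → (x * y) ^ℚ k ≡ x ^ℚ k * y ^ℚ k
  *-^ x y zero = sym (ℚP.*-identityˡ 1ℚ)
  *-^ x y (suc k) = trans (cong ((x * y) *_) (*-^ x y k)) (solve 4 (λ x y X Y → x :* y :* (X :* Y) := x :* X :* (y :* Y)) refl x y (x ^ℚ k) (y ^ℚ k))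

  ^-+ : ∀ x a b → x ^ℚ (a ℕ.+ b) ≡ x ^ℚ a * x ^ℚ b
  ^-+ x zero b = sym (ℚP.*-identityˡ _)
  ^-+ x (suc a) b = trans (cong (x *_) (^-+ x a b)) (sym (ℚP.*-assoc x _ _))

  recip-^ : ∀ n k .{{_ : NonZero n}} → recip (n ℕ.^ k) ≡ recip n ^ℚ k
  recip-^ n zero = trans (ℚP.*-identityˡ ((+ 1) ℚ./ 1)) refl
  recip-^ n (suc k) {{nz}} = trans (recip-* n (n ℕ.^ k) {{nz}} {{ℕP.m^n≢0 n k {{nz}}}}) (cong (recip n *_) (recip-^ n k {{nz}}))

  ∣^-^∣≤ : ∀ x y M k → ∣ x ∣ ≤ M → ∣ y ∣ ≤ M → M * ∣ x ^ℚ k - y ^ℚ k ∣ ≤ ℕtoℚ k * ∣ x - y ∣ * M ^ℚ k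
  ∣^-^∣≤ x y M zero hx hy = subst (_≤ ℕtoℚ 0 * ∣ x - y ∣ * 1ℚ) (sym (trans (cong (λ z → M * ∣ z ∣) (ℚP.+-inverseʳ 1ℚ)) (ℚP.*-zeroʳ M)))
    (subst (0ℚ ≤_) (sym (trans (cong (_* 1ℚ) (ℚP.*-zeroˡ ∣ x - y ∣)) (ℚP.*-zeroˡ 1ℚ))) ℚP.≤-refl)
  ∣^-^∣≤ x y M (suc k) hx hy = begin
      M * ∣ x * x ^ℚ k - y * y ^ℚ k ∣
    ≡⟨ cong (λ z → M * ∣ z ∣) (solve 4 (λ x y X Y → x :* X :- y :* Y := x :* (X :- Y) :+ Y :* (x :- y)) refl x y (x ^ℚ k) (y ^ℚ k)) ⟩
      M * ∣ x * (x ^ℚ k - y ^ℚ k) + y ^ℚ k * (x - y) ∣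
    ≤⟨ *-monoˡ M 0≤M (ℚP.∣p+q∣≤∣p∣+∣q∣ (x * (x ^ℚ k - y ^ℚ k)) (y ^ℚ k * (x - y))) ⟩
      M * (∣ x * (x ^ℚ k - y ^ℚ k) ∣ + ∣ y ^ℚ k * (x - y) ∣)
    ≡⟨ cong (λ z → M * (z + ∣ y ^ℚ k * (x - y) ∣)) (ℚP.∣p*q∣≡∣p∣*∣q∣ x _) ⟩
      M * (∣ x ∣ * ∣ x ^ℚ k - y ^ℚ k ∣ + ∣ y ^ℚ k * (x - y) ∣)
    ≡⟨ solve 3 (λ M A B → M :* (A :+ B) := M :* A :+ M :* B) refl M (∣ x ∣ * ∣ x ^ℚ k - y ^ℚ k ∣) (∣ y ^ℚ k * (x - y) ∣) ⟩
      M * (∣ x ∣ * ∣ x ^ℚ k - y ^ℚ k ∣) + M * ∣ y ^ℚ k * (x - y) ∣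
    ≡⟨ cong (_+ M * ∣ y ^ℚ k * (x - y) ∣) (solve 3 (λ M a b → M :* (a :* b) := a :* (M :* b)) refl M ∣ x ∣ _) ⟩
      ∣ x ∣ * (M * ∣ x ^ℚ k - y ^ℚ k ∣) + M * ∣ y ^ℚ k * (x - y) ∣
    ≤⟨ ℚP.+-mono-≤ (*-mono (ℚP.0≤∣p∣ x) (0≤* 0≤M (ℚP.0≤∣p∣ _)) hx (∣^-^∣≤ x y M k hx hy)) (*-monoˡ M 0≤M (∣*∣≤ (∣^∣≤ k hy) ℚP.≤-refl)) ⟩
      M * (ℕtoℚ k * ∣ x - y ∣ * M ^ℚ k) + M * (M ^ℚ k * ∣ x - y ∣)
    ≡⟨ solve 4 (λ M K D P → M :* (K :* D :* P) :+ M :* (P :* D) := (K :+ con 1ℚ) :* D :* (M :* P)) refl M (ℕtoℚ k) ∣ x - y ∣ (M ^ℚ k) ⟩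
      (ℕtoℚ k + 1ℚ) * ∣ x - y ∣ * (M * M ^ℚ k)
    ≡⟨ cong (λ z → z * ∣ x - y ∣ * (M * M ^ℚ k)) (trans (sym (ℕtoℚ-+ k 1)) (cong ℕtoℚ (ℕP.+-comm k 1))) ⟩
      ℕtoℚ (suc k) * ∣ x - y ∣ * M ^ℚ suc k
    ∎
    where
    open ℚP.≤-Reasoning
    0≤M : 0ℚ ≤ M
    0≤M = ℚP.≤-trans (ℚP.0≤∣p∣ x) hx


module RationalFloor where

  open RationalLemmas
  open import Defs
  open import Data.Nat as ℕ using (ℕ; zero; suc; NonZero)
  import Data.Nat.Properties as ℕP
  open import Data.Nat.DivMod as DM using (_/_; _%_)
  open import Data.Integer as ℤ using (ℤ; +_; -[1+_])
  import Data.Integer.Properties as ℤP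
  import Data.Integer.DivMod as ZDM
  open import Data.Integer.Tactic.RingSolver using (solve-∀)
  open import Data.Rational as ℚ using (ℚ; 1ℚ; mkℚ; _≤_)
  import Data.Rational.Properties as ℚP
  open import Data.Product using (_×_; _,_)
  open import Relation.Nullary using (yes; no; contradiction)
  open import Relation.Binary.PropositionalEquality

  ≤/⇒*≤ : ∀ n N D .{{_ : NonZero D}} → n ℕ.≤ N / D → n ℕ.* D ℕ.≤ N
  ≤/⇒*≤ n N D le = ℕP.≤-trans (ℕP.*-monoˡ-≤ D le) (DM.m/n*n≤m N D)

  *≤⇒≤/ : ∀ n N D .{{_ : NonZero D}} → n ℕ.* D ℕ.≤ N → n ℕ.≤ N / D
  *≤⇒≤/ n N D le with n ℕP.≤? N / D
  ... | yes p = p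
  ... | no np = contradiction le (ℕP.<⇒≱ (begin-strict
      N ≡⟨ DM.m≡m%n+[m/n]*n N D ⟩
      N % D ℕ.+ (N / D) ℕ.* D <⟨ ℕP.+-monoˡ-< ((N / D) ℕ.* D) (DM.m%n<n N D) ⟩
      D ℕ.+ (N / D) ℕ.* D ≡⟨ refl ⟩
      suc (N / D) ℕ.* D ≤⟨ ℕP.*-monoˡ-≤ D (ℕP.≰⇒> np) ⟩
      n ℕ.* D ∎))
    where open ℕP.≤-Reasoning

  record Floor (H : ℚ) : Set where
    field
      K : ℕ
      ≤H⇔≤K : ∀ n → (ℕtoℚ n ≤ H → n ℕ.≤ K) × (n ℕ.≤ K → ℕtoℚ n ≤ H)
      H≤suc-K : H ≤ ℕtoℚ (suc K)
      K≤∣ceiling∣ : K ℕ.≤ ℤ.∣ ℚ.ceiling H ∣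

  ℤ≤⇒ℕ : ∀ {m n} → + m ℤ.≤ + n → m ℕ.≤ n
  ℤ≤⇒ℕ (ℤ.+≤+ p) = p

  ≤∣∣ : ∀ {K z} → + K ℤ.≤ z → K ℕ.≤ ℤ.∣ z ∣
  ≤∣∣ {z = + m} (ℤ.+≤+ p) = p

  floor≤-ceiling : ∀ N' D' → + (suc N' / suc D') ℤ.≤ ℤ.- (-[1+ N' ] ZDM./ + suc D')
  floor≤-ceiling N' D' = ℤP.*-cancelʳ-≤-pos (+ K) (ℤ.- q) (+ D) (begin
      + K ℤ.* + D ≡⟨ sym (ℤP.pos-* K D) ⟩
      + (K ℕ.* D) ≤⟨ ℤ.+≤+ (DM.m/n*n≤m N D) ⟩
      + N ≤⟨ ℤP.i≤j+i (+ N) (+ r) ⟩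
      + r ℤ.+ + N ≡⟨ e ⟩
      ℤ.- q ℤ.* + D ∎)
    where
    open ℤP.≤-Reasoning
    D = suc D'
    N = suc N'
    K = N / D
    a = -[1+ N' ]
    q = a ZDM./ + D
    r = a ZDM.% + D
    eqa : a ≡ + r ℤ.+ q ℤ.* + D
    eqa = ZDM.a≡a%n+[a/n]*n a (+ D)
    cancel : ∀ r q D → r ℤ.- (r ℤ.+ q ℤ.* D) ≡ ℤ.- q ℤ.* D
    cancel = solve-∀
    e : + r ℤ.+ + N ≡ ℤ.- q ℤ.* + D
    e = begin-equality
        + r ℤ.+ + N ≡⟨ cong (λ z → + r ℤ.+ z) (sym (ℤP.neg-involutive (+ N))) ⟩
        + r ℤ.- a ≡⟨ cong (λ z → + r ℤ.- z) eqa ⟩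
        + r ℤ.- (+ r ℤ.+ q ℤ.* + D) ≡⟨ cancel (+ r) q (+ D) ⟩
        ℤ.- q ℤ.* + D ∎

  floor : ∀ H → 1ℚ ≤ H → Floor H
  floor (mkℚ (+ N) D-1 c) _ = record { K = K ; ≤H⇔≤K = λ n → ⇒ n , ⇐ n ; H≤suc-K = up ; K≤∣ceiling∣ = ib N refl }
    where
    D = suc D-1
    K = N / D
    H = mkℚ (+ N) D-1 c
    ⇒ : ∀ n → ℕtoℚ n ≤ H → n ℕ.≤ K
    ⇒ n le rewrite ℤtoℚ≡mkℚ (+ n) with le
    ... | ℚ.*≤* p = *≤⇒≤/ n N D (subst₂ ℕ._≤_ refl (ℕP.*-identityʳ N) (ℤ≤⇒ℕ (subst₂ ℤ._≤_ (sym (ℤP.pos-* n D)) (sym (ℤP.pos-* N 1)) p)))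
    ⇐ : ∀ n → n ℕ.≤ K → ℕtoℚ n ≤ H
    ⇐ n le rewrite ℤtoℚ≡mkℚ (+ n) = ℚ.*≤* (subst₂ ℤ._≤_ (ℤP.pos-* n D) (ℤP.pos-* N 1) (ℤ.+≤+ (subst (n ℕ.* D ℕ.≤_) (sym (ℕP.*-identityʳ N)) (≤/⇒*≤ n N D le))))
    up : H ≤ ℕtoℚ (suc K)
    up rewrite ℤtoℚ≡mkℚ (+ suc K) = ℚ.*≤* (subst₂ ℤ._≤_ (ℤP.pos-* N 1) (ℤP.pos-* (suc K) D) (ℤ.+≤+ (begin
        N ℕ.* 1 ≡⟨ ℕP.*-identityʳ N ⟩
        N ≡⟨ DM.m≡m%n+[m/n]*n N D ⟩
        N % D ℕ.+ K ℕ.* D ≤⟨ ℕP.+-monoˡ-≤ (K ℕ.* D) (ℕP.<⇒≤ (DM.m%n<n N D)) ⟩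
        suc K ℕ.* D ∎)))
      where open ℕP.≤-Reasoning
    ib : ∀ M → M ≡ N → K ℕ.≤ ℤ.∣ ℚ.ceiling H ∣
    ib zero refl = ℕ.z≤n
    ib (suc N') refl = ≤∣∣ (floor≤-ceiling N' D-1)
  floor (mkℚ -[1+ n ] D-1 c) le = contradiction (ℚP.≤-trans le (ℚP.nonPositive⁻¹ (mkℚ -[1+ n ] D-1 c) {{_}})) λ { (ℚ.*≤* (ℤ.+≤+ ())) }


module Sieve where

  open FiniteSums
  open RationalLemmas
  open import Defs
  open import Data.Nat as ℕ using (ℕ; suc; NonZero)
  import Data.Nat.Properties as ℕP
  open import Data.Nat.Divisibility as ND using (_∣?_; _∣_)
  open import Data.Nat.DivMod using (_/_)
  open import Data.Nat.Coprimality as NC using (Coprime)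
  open import Data.Nat.Primality using (Prime; prime⇒nonZero; prime⇒irreducible; prime⇒nonTrivial)
  open import Data.Nat.ListAction using (product)
  open import Data.Rational using (ℚ; 0ℚ; 1ℚ; _+_; _*_; _-_; -_; _≤_; ∣_∣)
  import Data.Rational.Properties as ℚP
  open import Data.Rational.Solver using (module +-*-Solver)
  open import Data.List using (List; []; _∷_)
  open import Data.List.Relation.Unary.All as All using (All; []; _∷_)
  open import Data.Unit using (⊤)
  open import Data.Product using (_×_; _,_; proj₁; proj₂)
  open import Data.Sum using (inj₁; inj₂)
  open import Relation.Nullary using (¬_; yes; no; contradiction)
  open import Relation.Nullary.Decidable using (¬?)
  open import Relation.Binary.PropositionalEquality
  open +-*-Solver

  coprime-* : ∀ {a b c} → Coprime a b → Coprime a c → Coprime a (b ℕ.* c)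
  coprime-* {a} {b} {c} cab cac {g} (g∣a , g∣bc) = cac (g∣a , NC.coprime-divisor cgb g∣bc)
    where
    cgb : Coprime g b
    cgb (h∣g , h∣b) = cab (ND.∣-trans h∣g g∣a , h∣b)

  prime≢1 : ∀ {p} → Prime p → p ≢ 1
  prime≢1 pp = ℕ.nonTrivial⇒≢1 {{prime⇒nonTrivial pp}}

  distinct-primes-coprime : ∀ {p q} → Prime p → Prime q → p ≢ q → Coprime p q
  distinct-primes-coprime {p} {q} pp pq p≢q {g} (g∣p , g∣q) with prime⇒irreducible pp g∣p
  ... | inj₁ g≡1 = g≡1
  ... | inj₂ refl with prime⇒irreducible pq g∣q
  ... | inj₁ p≡1 = contradiction p≡1 (prime≢1 pp)
  ... | inj₂ p≡q = contradiction p≡q p≢q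

  prime∤⇒coprime : ∀ {p c} → Prime p → ¬ (p ∣ c) → Coprime p c
  prime∤⇒coprime pp ¬p∣c {g} (g∣p , g∣c) with prime⇒irreducible pp g∣p
  ... | inj₁ g≡1 = g≡1
  ... | inj₂ refl = contradiction g∣c ¬p∣c

  module SieveWeight (d : ℕ) (pd : Prime d) where
    instance
      nzd : NonZero d
      nzd = prime⇒nonZero pd
      nzdd : NonZero (d ℕ.* d)
      nzdd = ℕP.m*n≢0 d d

    dd : ℕ
    dd = d ℕ.* d

    -- For L the prime divisors of s, weight L c = 1 exactly when a₀ = c s is an admissible
    -- constant coefficient; sumTo-weight-step removes one prime of L (inclusion–exclusion).
    weight : List ℕ → ℕ → ℕ
    weight [] b = 𝟙 (d ∣? b) ℕ.* 𝟙 (¬? (dd ∣? b))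
    weight (p ∷ L) b = 𝟙 (¬? (p ∣? b)) ℕ.* weight L b

    SievingPrimes : List ℕ → Set
    SievingPrimes [] = ⊤
    SievingPrimes (p ∷ L) = (Prime p × Coprime p d) × All (λ q → q ≢ p) L × SievingPrimes L

    weight-*prime : ∀ p → Prime p → Coprime p d → ∀ L → All (λ q → Prime q × q ≢ p) L → ∀ c → weight L (p ℕ.* c) ≡ weight L c
    weight-*prime p pp cpd [] [] c = cong₂ ℕ._*_ (𝟙-cong (d ∣? _) (d ∣? c) (NC.coprime-divisor cdp) (ND.∣n⇒∣m*n p))
        (𝟙-cong (¬? (dd ∣? _)) (¬? (dd ∣? c)) (λ h k → h (ND.∣n⇒∣m*n p k)) (λ h k → h (NC.coprime-divisor cddp k)))
      where
      cdp : Coprime d p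
      cdp = NC.sym cpd
      cddp : Coprime dd p
      cddp = NC.sym (coprime-* cpd cpd)
    weight-*prime p pp cpd (q ∷ L) ((pq , q≢p) ∷ al) c = cong₂ ℕ._*_
        (𝟙-cong (¬? (q ∣? _)) (¬? (q ∣? c)) (λ h k → h (ND.∣n⇒∣m*n p k)) (λ h k → h (NC.coprime-divisor (distinct-primes-coprime pq pp q≢p) k)))
        (weight-*prime p pp cpd L al c)

    sumTo-weight-step : ∀ p .{{_ : NonZero p}} → Prime p → Coprime p d → ∀ L → All (λ q → Prime q × q ≢ p) L → ∀ n →
      sumTo (weight (p ∷ L)) n ℕ.+ sumTo (weight L) (n / p) ≡ sumTo (weight L) n
    sumTo-weight-step p pp cpd L al n = begin
        sumTo (weight (p ∷ L)) n ℕ.+ sumTo (weight L) (n / p)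
      ≡⟨ cong (sumTo (weight (p ∷ L)) n ℕ.+_) (sym (trans (sumTo-multiples p (weight L) n) (sumTo-cong (n / p) (weight-*prime p pp cpd L al)))) ⟩
        sumTo (weight (p ∷ L)) n ℕ.+ sumTo (λ b → 𝟙 (p ∣? b) ℕ.* weight L b) n
      ≡⟨ sym (sumBelow-+ _ _ n) ⟩
        sumBelow (λ k → weight (p ∷ L) (suc k) ℕ.+ 𝟙 (p ∣? suc k) ℕ.* weight L (suc k)) n
      ≡⟨ sumBelow-cong n (λ k _ → 𝟙-¬+𝟙 (weight L (suc k)) (p ∣? suc k)) ⟩
        sumTo (weight L) n
      ∎
      where
      open ≡-Reasoning

    sumTo-weight-base : ∀ n → sumTo (weight []) n ℕ.+ n / dd ≡ n / d
    sumTo-weight-base n = begin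
        sumTo (weight []) n ℕ.+ n / dd
      ≡⟨ cong (sumTo (weight []) n ℕ.+_) (sym (sumTo-𝟙∣ dd n)) ⟩
        sumTo (weight []) n ℕ.+ sumTo (λ b → 𝟙 (dd ∣? b)) n
      ≡⟨ sym (sumBelow-+ _ _ n) ⟩
        sumBelow (λ k → weight [] (suc k) ℕ.+ 𝟙 (dd ∣? suc k)) n
      ≡⟨ sumBelow-cong n (λ k _ → pw (suc k)) ⟩
        sumTo (λ b → 𝟙 (d ∣? b)) n
      ≡⟨ sumTo-𝟙∣ d n ⟩
        n / d
      ∎
      where
      open ≡-Reasoning
      pw : ∀ b → weight [] b ℕ.+ 𝟙 (dd ∣? b) ≡ 𝟙 (d ∣? b)
      pw b with dd ∣? b
      ... | yes h = trans (cong₂ ℕ._+_ (ℕP.*-zeroʳ (𝟙 (d ∣? b))) refl) (sym (𝟙-yes (d ∣? b) (ND.∣-trans (ND.m∣m*n d) h)))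
      ... | no _ = trans (ℕP.+-identityʳ _) (ℕP.*-identityʳ _)

    ρ : List ℕ → ℚ
    ρ [] = recip d * (1ℚ - recip d)
    ρ (p ∷ L) = ρ L * (1ℚ - recip p)

    E : List ℕ → ℕ
    E [] = 2
    E (p ∷ L) = 2 ℕ.* E L ℕ.+ 1

    ρ-bounds : ∀ L → SievingPrimes L → 0ℚ ≤ ρ L × ρ L ≤ 1ℚ
    ρ-bounds [] _ = 0≤* (recip-nonneg d) (proj₁ (0≤1-recip≤1 d)) , ℚP.≤-trans (*-mono (recip-nonneg d) (proj₁ (0≤1-recip≤1 d)) (recip≤1 d) (proj₂ (0≤1-recip≤1 d))) (ℚP.≤-reflexive (ℚP.*-identityˡ 1ℚ))
    ρ-bounds (p ∷ L) ((pp , _) , _ , g) = 0≤* (proj₁ ih) (proj₁ (0≤1-recip≤1 p {{prime⇒nonZero pp}})) ,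
         ℚP.≤-trans (*-mono (proj₁ ih) (proj₁ (0≤1-recip≤1 p {{prime⇒nonZero pp}})) (proj₂ ih) (proj₂ (0≤1-recip≤1 p {{prime⇒nonZero pp}}))) (ℚP.≤-reflexive (ℚP.*-identityˡ 1ℚ))
      where ih = ρ-bounds L g

    sievingPrimes-prime : ∀ L → SievingPrimes L → All Prime L
    sievingPrimes-prime [] _ = []
    sievingPrimes-prime (p ∷ L) ((pp , _) , _ , g) = pp ∷ sievingPrimes-prime L g

    sumTo-weight-approx : ∀ L → SievingPrimes L → ∀ n → ∣ ℕtoℚ (sumTo (weight L) n) - ℕtoℚ n * ρ L ∣ ≤ ℕtoℚ (E L)
    sumTo-weight-approx [] _ n = subst (λ z → ∣ z ∣ ≤ ℕtoℚ 2) (sym eq) (triangle₂ (ℕtoℚ (n / d) - ℕtoℚ n * recip d) (ℕtoℚ (n / dd) - ℕtoℚ n * recip dd) (∣n/p-n*recip∣≤1 n d) (∣n/p-n*recip∣≤1 n dd))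
      where
      open ≡-Reasoning
      eq : ℕtoℚ (sumTo (weight []) n) - ℕtoℚ n * ρ [] ≡ (ℕtoℚ (n / d) - ℕtoℚ n * recip d) - (ℕtoℚ (n / dd) - ℕtoℚ n * recip dd)
      eq = begin
        ℕtoℚ (sumTo (weight []) n) - ℕtoℚ n * ρ [] ≡⟨ cong₂ (λ a b → a - ℕtoℚ n * b) (ℕtoℚ-∸ _ (n / dd) _ (sumTo-weight-base n)) (solve 1 (λ i → i :* (con 1ℚ :- i) := i :- i :* i) refl (recip d)) ⟩
        (ℕtoℚ (n / d) - ℕtoℚ (n / dd)) - ℕtoℚ n * (recip d - recip d * recip d) ≡⟨ cong (λ z → (ℕtoℚ (n / d) - ℕtoℚ (n / dd)) - ℕtoℚ n * (recip d - z)) (sym (recip-* d d)) ⟩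
        (ℕtoℚ (n / d) - ℕtoℚ (n / dd)) - ℕtoℚ n * (recip d - recip dd) ≡⟨ solve 5 (λ a b N x y → (a :- b) :- N :* (x :- y) := (a :- N :* x) :- (b :- N :* y)) refl (ℕtoℚ (n / d)) (ℕtoℚ (n / dd)) (ℕtoℚ n) (recip d) (recip dd) ⟩
        (ℕtoℚ (n / d) - ℕtoℚ n * recip d) - (ℕtoℚ (n / dd) - ℕtoℚ n * recip dd) ∎
    sumTo-weight-approx (p ∷ L) gl@((pp , cpd) , ne , g) n = subst (λ z → ∣ z ∣ ≤ ℕtoℚ (E (p ∷ L))) (sym eq) (subst (∣ (Nn - ℕtoℚ n * ρ L) - (Nm - ℕtoℚ m * ρ L) + ρ L * - (ℕtoℚ m - ℕtoℚ n * recip p) ∣ ≤_) (sym Eeq)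
        (triangle₃ (Nn - ℕtoℚ n * ρ L) (Nm - ℕtoℚ m * ρ L) (ρ L * - (ℕtoℚ m - ℕtoℚ n * recip p)) (sumTo-weight-approx L g n) (sumTo-weight-approx L g m) (∣[0,1]*p∣≤ (proj₁ rb) (proj₂ rb) (∣-p∣≤ (∣n/p-n*recip∣≤1 n p)))))
      where
      instance nzp : NonZero p
               nzp = prime⇒nonZero pp
      m = n / p
      rb = ρ-bounds L g
      open ≡-Reasoning
      Eeq : ℕtoℚ (E (p ∷ L)) ≡ ℕtoℚ (E L) + ℕtoℚ (E L) + 1ℚ
      Eeq = trans (ℕtoℚ-+ (2 ℕ.* E L) 1) (cong (_+ 1ℚ) (trans (cong ℕtoℚ (cong (E L ℕ.+_) (ℕP.+-identityʳ (E L)))) (ℕtoℚ-+ (E L) (E L))))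
      Nn = ℕtoℚ (sumTo (weight L) n)
      Nm = ℕtoℚ (sumTo (weight L) m)
      eq : ℕtoℚ (sumTo (weight (p ∷ L)) n) - ℕtoℚ n * ρ (p ∷ L) ≡ (Nn - ℕtoℚ n * ρ L) - (Nm - ℕtoℚ m * ρ L) + ρ L * - (ℕtoℚ m - ℕtoℚ n * recip p)
      eq = begin
        ℕtoℚ (sumTo (weight (p ∷ L)) n) - ℕtoℚ n * (ρ L * (1ℚ - recip p)) ≡⟨ cong (_- ℕtoℚ n * (ρ L * (1ℚ - recip p))) (ℕtoℚ-∸ _ (sumTo (weight L) m) _ (sumTo-weight-step p pp cpd L (All.zip (sievingPrimes-prime L g , ne)) n)) ⟩
        (Nn - Nm) - ℕtoℚ n * (ρ L * (1ℚ - recip p)) ≡⟨ solve 6 (λ a b N M r i → (a :- b) :- N :* (r :* (con 1ℚ :- i)) := (a :- N :* r) :- (b :- M :* r) :+ r :* (:- (M :- N :* i))) refl Nn Nm (ℕtoℚ n) (ℕtoℚ m) (ρ L) (recip p) ⟩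
        (Nn - ℕtoℚ n * ρ L) - (Nm - ℕtoℚ m * ρ L) + ρ L * - (ℕtoℚ m - ℕtoℚ n * recip p) ∎

    sumTo-weight-exact : ∀ L → SievingPrimes L → ∀ n → (dd ℕ.* product L) ∣ n → ℕtoℚ (sumTo (weight L) n) ≡ ℕtoℚ n * ρ L
    sumTo-weight-exact [] _ n h = begin
        ℕtoℚ (sumTo (weight []) n) ≡⟨ ℕtoℚ-∸ _ (n / dd) _ (sumTo-weight-base n) ⟩
        ℕtoℚ (n / d) - ℕtoℚ (n / dd) ≡⟨ cong₂ _-_ (ℕtoℚ-/-exact n d (ND.∣-trans (ND.m∣m*n d) hdd)) (ℕtoℚ-/-exact n dd hdd) ⟩
        ℕtoℚ n * recip d - ℕtoℚ n * recip dd ≡⟨ cong (λ z → ℕtoℚ n * recip d - ℕtoℚ n * z) (recip-* d d) ⟩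
        ℕtoℚ n * recip d - ℕtoℚ n * (recip d * recip d) ≡⟨ solve 2 (λ N i → N :* i :- N :* (i :* i) := N :* (i :* (con 1ℚ :- i))) refl (ℕtoℚ n) (recip d) ⟩
        ℕtoℚ n * ρ [] ∎
      where
      open ≡-Reasoning
      hdd : dd ∣ n
      hdd = ND.∣-trans (ND.∣-reflexive (sym (ℕP.*-identityʳ dd))) h
    sumTo-weight-exact (p ∷ L) ((pp , cpd) , ne , g) n h = begin
        ℕtoℚ (sumTo (weight (p ∷ L)) n) ≡⟨ ℕtoℚ-∸ _ (sumTo (weight L) m) _ (sumTo-weight-step p pp cpd L (All.zip (sievingPrimes-prime L g , ne)) n) ⟩
        ℕtoℚ (sumTo (weight L) n) - ℕtoℚ (sumTo (weight L) m) ≡⟨ cong₂ _-_ (sumTo-weight-exact L g n h1) (sumTo-weight-exact L g m h2) ⟩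
        ℕtoℚ n * ρ L - ℕtoℚ m * ρ L ≡⟨ cong (λ z → ℕtoℚ n * ρ L - z * ρ L) (ℕtoℚ-/-exact n p hp) ⟩
        ℕtoℚ n * ρ L - ℕtoℚ n * recip p * ρ L ≡⟨ solve 3 (λ N r i → N :* r :- N :* i :* r := N :* (r :* (con 1ℚ :- i))) refl (ℕtoℚ n) (ρ L) (recip p) ⟩
        ℕtoℚ n * ρ (p ∷ L) ∎
      where
      open ≡-Reasoning
      instance nzp : NonZero p
               nzp = prime⇒nonZero pp
      m = n / p
      re : dd ℕ.* (p ℕ.* product L) ≡ (dd ℕ.* product L) ℕ.* p
      re = trans (cong (dd ℕ.*_) (ℕP.*-comm p (product L))) (sym (ℕP.*-assoc dd (product L) p))
      h' : (dd ℕ.* product L) ℕ.* p ∣ n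
      h' = subst (_∣ n) re h
      h1 : dd ℕ.* product L ∣ n
      h1 = ND.m*n∣⇒m∣ (dd ℕ.* product L) p h'
      h2 : dd ℕ.* product L ∣ m
      h2 = ND.m*n∣o⇒m∣o/n (dd ℕ.* product L) p h'
      hp : p ∣ n
      hp = ND.m*n∣⇒n∣ (dd ℕ.* product L) p h'


module SieveDensity where

  open FiniteSums
  open RationalLemmas
  open Sieve
  open import Defs
  open import Data.Nat as ℕ using (ℕ; suc; NonZero)
  import Data.Nat.Properties as ℕP
  import Algebra.Properties.CommutativeSemigroup ℕP.*-commutativeSemigroup as *-CS
  open import Data.Nat.Tactic.RingSolver using (solve-∀)
  open import Data.Nat.Divisibility as ND using (_∣?_; _∣_)
  open import Data.Nat.DivMod as DM using (_/_)
  open import Data.Nat.Coprimality as NC using (Coprime; coprime?)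
  open import Data.Nat.Primality using (Prime; prime?; prime⇒nonZero)
  open import Data.Nat.Primality.Factorisation using (factorise)
  open import Data.Nat.ListAction using (product)
  open import Data.Nat.ListAction.Properties using (product≢0)
  open import Data.List using (List; []; _∷_; map; upTo; filter; length)
  import Data.List.Properties as LP
  open import Data.List.Relation.Unary.All as All using (All; []; _∷_; all?)
  open import Data.List.Relation.Unary.AllPairs using (_∷_; [])
  open import Data.List.Membership.Propositional using (_∈_)
  import Data.List.Membership.Propositional.Properties as MP
  import Data.List.Relation.Unary.Unique.Propositional as U
  import Data.List.Relation.Unary.Unique.Propositional.Properties as UP
  open import Data.Rational using (_*_; _-_; -_; _≤_; ∣_∣)
  import Data.Rational.Properties as ℚP
  open import Data.Rational.Solver using (module +-*-Solver)
  open import Data.Product using (_×_; _,_; proj₁; proj₂; ∃; uncurry)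
  open import Function using (_∘_)
  open import Relation.Nullary using (¬_; yes; no; contradiction)
  open import Relation.Nullary.Decidable using (¬?; _×-dec_)
  open import Relation.Binary.PropositionalEquality
  open +-*-Solver

  primeDivisors : ℕ → List ℕ
  primeDivisors s = filter (λ p → prime? p ×-dec (p ∣? s)) (upTo (suc s))

  φ≡sumTo : ∀ n → φ n ≡ sumTo (λ c → 𝟙 (coprime? c n)) n
  φ≡sumTo n = trans (length-filter≡sumList (λ k → coprime? k n) (map suc (upTo n)))
    (trans (cong (sumList (λ k → 𝟙 (coprime? k n))) (LP.map-upTo suc n)) (sumList-applyUpTo _ suc n))

  ∈primeDivisors⁻ : ∀ {s p} → p ∈ primeDivisors s → Prime p × p ∣ s
  ∈primeDivisors⁻ {s} m = proj₂ (MP.∈-filter⁻ (λ p → prime? p ×-dec (p ∣? s)) {xs = upTo (suc s)} m)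

  ∈primeDivisors⁺ : ∀ {s p} .{{_ : NonZero s}} → Prime p → p ∣ s → p ∈ primeDivisors s
  ∈primeDivisors⁺ {s} pp p∣s = MP.∈-filter⁺ (λ p → prime? p ×-dec (p ∣? s)) (MP.∈-upTo⁺ (ℕ.s≤s (ND.∣⇒≤ p∣s))) (pp , p∣s)

  ∃primeDivisor : ∀ g .{{_ : NonZero g}} → g ≢ 1 → ∃ λ p → Prime p × p ∣ g
  ∃primeDivisor g g≢1 with factorise g
  ... | record { factors = [] ; isFactorisation = e } = contradiction e g≢1
  ... | record { factors = p ∷ ps ; isFactorisation = e ; factorsPrime = pp ∷ _ } =
    p , pp , ND.∣-trans (ND.m∣m*n (product ps)) (ND.∣-reflexive (sym e))

  ∣-+-shift : ∀ {m T b} → m ∣ T → (m ∣ T ℕ.+ b → m ∣ b) × (m ∣ b → m ∣ T ℕ.+ b)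
  ∣-+-shift h = (λ k → ND.∣m+n∣m⇒∣n k h) , (λ k → ND.∣m∣n⇒∣m+n h k)

  𝟙-∣-shift : ∀ {m T} b → m ∣ T → 𝟙 (m ∣? (T ℕ.+ b)) ≡ 𝟙 (m ∣? b)
  𝟙-∣-shift b h = 𝟙-cong (_ ∣? _) (_ ∣? b) (proj₁ (∣-+-shift h)) (proj₂ (∣-+-shift h))

  𝟙-∤-shift : ∀ {m T} b → m ∣ T → 𝟙 (¬? (m ∣? (T ℕ.+ b))) ≡ 𝟙 (¬? (m ∣? b))
  𝟙-∤-shift b h = 𝟙-cong (¬? (_ ∣? _)) (¬? (_ ∣? b)) (λ x y → x (proj₂ (∣-+-shift h) y)) (λ x y → x (proj₁ (∣-+-shift h) y))

  module TotientDensity (d : ℕ) (pd : Prime d) (s : ℕ) .{{_ : NonZero s}} (s⊥d : Coprime s d) where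
    open SieveWeight d pd

    P : List ℕ
    P = primeDivisors s

    primeDivisors-prime∣ : All (λ p → Prime p × p ∣ s) P
    primeDivisors-prime∣ = All.tabulate ∈primeDivisors⁻

    primeDivisors-unique : U.Unique P
    primeDivisors-unique = UP.filter⁺ (λ p → prime? p ×-dec (p ∣? s)) (UP.upTo⁺ (suc s))

    sievingPrimes-from : ∀ L → All (λ p → Prime p × p ∣ s) L → U.Unique L → SievingPrimes L
    sievingPrimes-from [] _ _ = _
    sievingPrimes-from (p ∷ L) ((pp , p∣s) ∷ al) (ne ∷ un) = (pp , p⊥d) , All.map (λ x eq → x (sym eq)) ne , sievingPrimes-from L al un
      where
      p⊥d : Coprime p d
      p⊥d (g∣p , g∣d) = s⊥d (ND.∣-trans g∣p p∣s , g∣d)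

    primeDivisors-sieving : SievingPrimes P
    primeDivisors-sieving = sievingPrimes-from P primeDivisors-prime∣ primeDivisors-unique

    d²∤-avoids : List ℕ → ℕ → ℕ
    d²∤-avoids [] b = 𝟙 (¬? (dd ∣? b))
    d²∤-avoids (p ∷ L) b = 𝟙 (¬? (p ∣? b)) ℕ.* d²∤-avoids L b

    weight≡𝟙∣*d²∤-avoids : ∀ L b → weight L b ≡ 𝟙 (d ∣? b) ℕ.* d²∤-avoids L b
    weight≡𝟙∣*d²∤-avoids [] b = refl
    weight≡𝟙∣*d²∤-avoids (p ∷ L) b = trans (cong (𝟙 (¬? (p ∣? b)) ℕ.*_) (weight≡𝟙∣*d²∤-avoids L b))
      (trans (sym (ℕP.*-assoc (𝟙 (¬? (p ∣? b))) (𝟙 (d ∣? b)) (d²∤-avoids L b))) (trans (cong (ℕ._* d²∤-avoids L b) (ℕP.*-comm (𝟙 (¬? (p ∣? b))) (𝟙 (d ∣? b)))) (ℕP.*-assoc (𝟙 (d ∣? b)) (𝟙 (¬? (p ∣? b))) (d²∤-avoids L b))))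

    avoids : List ℕ → ℕ → ℕ
    avoids [] c = 1
    avoids (p ∷ L) c = 𝟙 (¬? (p ∣? c)) ℕ.* avoids L c

    d²∤-avoids-d* : ∀ L → All (λ p → Prime p × p ∣ s) L → ∀ c → d²∤-avoids L (d ℕ.* c) ≡ 𝟙 (¬? (d ∣? c)) ℕ.* avoids L c
    d²∤-avoids-d* [] [] c = trans (𝟙-cong (¬? (dd ∣? _)) (¬? (d ∣? c)) (λ h k → h (ND.*-monoʳ-∣ d k)) (λ h k → h (ND.*-cancelˡ-∣ d (subst (_∣ d ℕ.* c) refl k))))
      (sym (ℕP.*-identityʳ _))
    d²∤-avoids-d* (p ∷ L) ((pp , p∣s) ∷ al) c = begin
        𝟙 (¬? (p ∣? (d ℕ.* c))) ℕ.* d²∤-avoids L (d ℕ.* c)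
      ≡⟨ cong₂ ℕ._*_ (𝟙-cong (¬? (p ∣? _)) (¬? (p ∣? c)) (λ h k → h (ND.∣n⇒∣m*n d k)) (λ h k → h (NC.coprime-divisor p⊥d k))) (d²∤-avoids-d* L al c) ⟩
        𝟙 (¬? (p ∣? c)) ℕ.* (𝟙 (¬? (d ∣? c)) ℕ.* avoids L c)
      ≡⟨ trans (sym (ℕP.*-assoc (𝟙 (¬? (p ∣? c))) (𝟙 (¬? (d ∣? c))) (avoids L c))) (trans (cong (ℕ._* avoids L c) (ℕP.*-comm (𝟙 (¬? (p ∣? c))) (𝟙 (¬? (d ∣? c))))) (ℕP.*-assoc (𝟙 (¬? (d ∣? c))) (𝟙 (¬? (p ∣? c))) (avoids L c))) ⟩
        𝟙 (¬? (d ∣? c)) ℕ.* (𝟙 (¬? (p ∣? c)) ℕ.* avoids L c)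
      ∎
      where
      open ≡-Reasoning
      p⊥d : Coprime p d
      p⊥d (g∣p , g∣d) = s⊥d (ND.∣-trans g∣p p∣s , g∣d)

    avoids≡𝟙-all : ∀ L c → avoids L c ≡ 𝟙 (all? (λ p → ¬? (p ∣? c)) L)
    avoids≡𝟙-all [] c = refl
    avoids≡𝟙-all (p ∷ L) c = trans (cong (𝟙 (¬? (p ∣? c)) ℕ.*_) (avoids≡𝟙-all L c))
      (trans (sym (𝟙-× (¬? (p ∣? c)) (all? (λ p → ¬? (p ∣? c)) L)))
        (𝟙-cong (¬? (p ∣? c) ×-dec all? (λ p → ¬? (p ∣? c)) L) (all? (λ p → ¬? (p ∣? c)) (p ∷ L)) (uncurry _∷_) All.uncons))

    avoids⇒coprime : ∀ c → All (λ p → ¬ (p ∣ c)) P → Coprime c s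
    avoids⇒coprime c al {g} (g∣c , g∣s) with g ℕ.≟ 1
    ... | yes e = e
    ... | no g≢1 with ∃primeDivisor g {{gnz}} g≢1
      where
      gnz : NonZero g
      gnz = ℕ.≢-nonZero λ { refl → ℕ.≢-nonZero⁻¹ s (ND.0∣⇒≡0 g∣s) }
    ... | p , pp , p∣g = contradiction (ND.∣-trans p∣g g∣c) (All.lookup al (∈primeDivisors⁺ pp (ND.∣-trans p∣g g∣s)))

    coprime⇒avoids : ∀ c → Coprime c s → All (λ p → ¬ (p ∣ c)) P
    coprime⇒avoids c cp = All.tabulate (λ {p} m p∣c → prime≢1 (proj₁ (∈primeDivisors⁻ {s} m)) (cp (p∣c , proj₂ (∈primeDivisors⁻ {s} m))))

    coprime-ds⇐ : ∀ c → ¬ (d ∣ c) × All (λ p → ¬ (p ∣ c)) P → Coprime c (d ℕ.* s)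
    coprime-ds⇐ c (nd , al) = coprime-* (NC.sym (prime∤⇒coprime pd nd)) (avoids⇒coprime c al)

    coprime-ds⇒ : ∀ c → Coprime c (d ℕ.* s) → ¬ (d ∣ c) × All (λ p → ¬ (p ∣ c)) P
    coprime-ds⇒ c cp = (λ d∣c → prime≢1 pd (cp (d∣c , ND.m∣m*n s))) ,
      coprime⇒avoids c (λ (g∣c , g∣s) → cp (g∣c , ND.∣n⇒∣m*n d g∣s))

    sumTo-weight-period : sumTo (weight P) (dd ℕ.* s) ≡ φ (d ℕ.* s)
    sumTo-weight-period = begin
        sumTo (weight P) (dd ℕ.* s)
      ≡⟨ sumTo-cong (dd ℕ.* s) (weight≡𝟙∣*d²∤-avoids P) ⟩
        sumTo (λ b → 𝟙 (d ∣? b) ℕ.* d²∤-avoids P b) (dd ℕ.* s)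
      ≡⟨ sumTo-multiples d (d²∤-avoids P) (dd ℕ.* s) ⟩
        sumTo (λ c → d²∤-avoids P (d ℕ.* c)) (dd ℕ.* s / d)
      ≡⟨ cong (sumTo (λ c → d²∤-avoids P (d ℕ.* c))) e ⟩
        sumTo (λ c → d²∤-avoids P (d ℕ.* c)) (d ℕ.* s)
      ≡⟨ sumTo-cong (d ℕ.* s) (λ c → trans (d²∤-avoids-d* P primeDivisors-prime∣ c) (trans (cong (𝟙 (¬? (d ∣? c)) ℕ.*_) (avoids≡𝟙-all P c))
           (trans (sym (𝟙-× (¬? (d ∣? c)) (all? (λ p → ¬? (p ∣? c)) P)))
             (𝟙-cong (¬? (d ∣? c) ×-dec all? (λ p → ¬? (p ∣? c)) P) (coprime? c (d ℕ.* s)) (coprime-ds⇐ c) (coprime-ds⇒ c))))) ⟩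
        sumTo (λ c → 𝟙 (coprime? c (d ℕ.* s))) (d ℕ.* s)
      ≡⟨ sym (φ≡sumTo (d ℕ.* s)) ⟩
        φ (d ℕ.* s)
      ∎
      where
      open ≡-Reasoning
      e : dd ℕ.* s / d ≡ d ℕ.* s
      e = trans (cong (_/ d) (trans (ℕP.*-assoc d d s) (ℕP.*-comm d (d ℕ.* s)))) (DM.m*n/n≡m (d ℕ.* s) d)

    T : ℕ
    T = dd ℕ.* s

    primeDivisors-∣period : All (λ p → p ∣ T) P
    primeDivisors-∣period = All.map (λ { (_ , p∣s) → ND.∣n⇒∣m*n dd p∣s }) primeDivisors-prime∣

    weight-periodic : ∀ L → All (λ p → p ∣ T) L → ∀ b → weight L (T ℕ.+ b) ≡ weight L b
    weight-periodic [] [] b = cong₂ ℕ._*_ (𝟙-∣-shift {d} {T} b (ND.∣-trans (ND.m∣m*n d) (ND.m∣m*n s))) (𝟙-∤-shift {dd} {T} b (ND.m∣m*n s))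
    weight-periodic (p ∷ L) (h ∷ a) b = cong₂ ℕ._*_ (𝟙-∤-shift b h) (weight-periodic L a b)
    instance
      nzΠ : NonZero (product P)
      nzΠ = product≢0 (All.map (prime⇒nonZero ∘ proj₁) primeDivisors-prime∣)

    T*ρ≡φ : ℕtoℚ T * ρ P ≡ ℕtoℚ (φ (d ℕ.* s))
    T*ρ≡φ = *-cancelˡ-ℕtoℚ (product P) (begin
        ℕtoℚ (product P) * (ℕtoℚ T * ρ P)
      ≡⟨ sym (ℚP.*-assoc (ℕtoℚ (product P)) _ _) ⟩
        ℕtoℚ (product P) * ℕtoℚ T * ρ P
      ≡⟨ cong (_* ρ P) (sym (ℕtoℚ-* (product P) T)) ⟩
        ℕtoℚ (product P ℕ.* T) * ρ P
      ≡⟨ sym (sumTo-weight-exact P primeDivisors-sieving (product P ℕ.* T) dd*product∣product*T) ⟩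
        ℕtoℚ (sumTo (weight P) (product P ℕ.* T))
      ≡⟨ cong ℕtoℚ (sumTo-periodic (weight P) T (weight-periodic P primeDivisors-∣period) (product P)) ⟩
        ℕtoℚ (product P ℕ.* sumTo (weight P) T)
      ≡⟨ cong (λ n → ℕtoℚ (product P ℕ.* n)) sumTo-weight-period ⟩
        ℕtoℚ (product P ℕ.* φ (d ℕ.* s))
      ≡⟨ ℕtoℚ-* (product P) _ ⟩
        ℕtoℚ (product P) * ℕtoℚ (φ (d ℕ.* s))
      ∎)
      where
      open ≡-Reasoning
      dd*product∣product*T : dd ℕ.* product P ∣ product P ℕ.* T
      dd*product∣product*T = ND.∣-trans (ND.m∣m*n s) (ND.∣-reflexive (trans (cong (ℕ._* s) (ℕP.*-comm dd (product P))) (ℕP.*-assoc (product P) dd s)))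

    ρ≡φ*recip : ρ P ≡ ℕtoℚ (φ (d ℕ.* s)) * recip T
    ρ≡φ*recip = n*x≡y⇒x≡y*recip T {{ℕP.m*n≢0 dd s}} T*ρ≡φ

    sumTo-weight-φ-approx : ∀ n → ∣ ℕtoℚ (sumTo (weight P) n) - ℕtoℚ n * (ℕtoℚ (φ (d ℕ.* s)) * recip T) ∣ ≤ ℕtoℚ (E P)
    sumTo-weight-φ-approx n = subst (λ z → ∣ ℕtoℚ (sumTo (weight P) n) - ℕtoℚ n * z ∣ ≤ ℕtoℚ (E P)) ρ≡φ*recip (sumTo-weight-approx P primeDivisors-sieving n)

    E+1≡3*2^length : ∀ L → E L ℕ.+ 1 ≡ 3 ℕ.* 2 ℕ.^ length L
    E+1≡3*2^length [] = refl
    E+1≡3*2^length (p ∷ L) = begin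
        2 ℕ.* E L ℕ.+ 1 ℕ.+ 1 ≡⟨ double+2 (E L) ⟩
        2 ℕ.* (E L ℕ.+ 1) ≡⟨ cong (2 ℕ.*_) (E+1≡3*2^length L) ⟩
        2 ℕ.* (3 ℕ.* 2 ℕ.^ length L) ≡⟨ *-CS.x∙yz≈y∙xz 2 3 (2 ℕ.^ length L) ⟩
        3 ℕ.* 2 ℕ.^ length (p ∷ L) ∎
      where
      open ≡-Reasoning
      double+2 : ∀ e → 2 ℕ.* e ℕ.+ 1 ℕ.+ 1 ≡ 2 ℕ.* (e ℕ.+ 1)
      double+2 = solve-∀

    E≤3*2^ω : E P ℕ.≤ 3 ℕ.* 2 ℕ.^ ω s
    E≤3*2^ω = ℕP.≤-trans (ℕP.m≤m+n (E P) 1) (ℕP.≤-reflexive (E+1≡3*2^length P))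

    avoids-primeDivisors : ∀ c → avoids P c ≡ 𝟙 (coprime? c s)
    avoids-primeDivisors c = trans (avoids≡𝟙-all P c) (𝟙-cong (all? (λ p → ¬? (p ∣? c)) P) (coprime? c s) (avoids⇒coprime c) (coprime⇒avoids c))

    d²∤-avoids≡ : ∀ L b → d²∤-avoids L b ≡ 𝟙 (¬? (dd ∣? b)) ℕ.* avoids L b
    d²∤-avoids≡ [] b = sym (ℕP.*-identityʳ _)
    d²∤-avoids≡ (p ∷ L) b = trans (cong (𝟙 (¬? (p ∣? b)) ℕ.*_) (d²∤-avoids≡ L b)) (*-CS.x∙yz≈y∙xz (𝟙 (¬? (p ∣? b))) (𝟙 (¬? (dd ∣? b))) (avoids L b))

    weight-primeDivisors : ∀ c → weight P c ≡ 𝟙 (d ∣? c) ℕ.* (𝟙 (¬? (dd ∣? c)) ℕ.* 𝟙 (coprime? c s))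
    weight-primeDivisors c = trans (weight≡𝟙∣*d²∤-avoids P c) (cong (𝟙 (d ∣? c) ℕ.*_) (trans (d²∤-avoids≡ P c) (cong (𝟙 (¬? (dd ∣? c)) ℕ.*_) (avoids-primeDivisors c))))


module IntegerWindows where

  open FiniteSums
  open import Defs
  open import Data.Nat as ℕ using (ℕ; zero; suc; NonZero)
  import Data.Nat.Properties as ℕP
  open import Data.Nat.Tactic.RingSolver using (solve-∀)
  import Data.Nat.Divisibility as ND
  open import Data.Nat.DivMod as DM using (_/_; _%_)
  open import Data.Integer as ℤ using (ℤ; +_; -[1+_])
  import Data.Integer.Properties as ℤP
  import Data.Integer.Divisibility.Signed as ZD
  open import Data.Integer.Tactic.RingSolver using () renaming (solve-∀ to ℤ-solve-∀)
  open import Data.List using (upTo)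
  open import Data.Product using (_×_; _,_; proj₁; proj₂)
  open import Function using (_∘_; id)
  open import Relation.Nullary using (¬_)
  open import Relation.Binary.PropositionalEquality

  windowSum : (ℤ → ℕ) → ℤ → ℕ → ℕ
  windowSum f a n = sumBelow (λ k → f (a ℤ.+ + k)) n

  negℕ : ℕ → ℤ
  negℕ n = ℤ.- (+ n)

  windowSum-cong : ∀ {f g} a n → (∀ x → f x ≡ g x) → windowSum f a n ≡ windowSum g a n
  windowSum-cong a n e = sumBelow-cong n (λ k _ → e _)

  windowSum-split : ∀ f a m n → windowSum f a (m ℕ.+ n) ≡ windowSum f a m ℕ.+ windowSum f (a ℤ.+ + m) n
  windowSum-split f a m n = trans (sumBelow-split _ m n) (cong (windowSum f a m ℕ.+_) (sumBelow-cong n (λ k _ → cong f (trans (cong (λ z → a ℤ.+ z) (ℤP.pos-+ m k)) (sym (ℤP.+-assoc a (+ m) (+ k)))))))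

  windowSum-suc : ∀ f a n → windowSum f a (suc n) ≡ f a ℕ.+ windowSum f (a ℤ.+ + 1) n
  windowSum-suc f a n = trans (windowSum-split f a 1 n) (cong (ℕ._+ windowSum f (a ℤ.+ + 1) n) (trans (ℕP.+-identityʳ _) (cong f (ℤP.+-identityʳ a))))

  windowSum-snoc : ∀ f a n → windowSum f a (suc n) ≡ windowSum f a n ℕ.+ f (a ℤ.+ + n)
  windowSum-snoc f a n = sumBelow-snoc _ n

  sumList-intsUpTo : ∀ f B → sumList f (intsUpTo B) ≡ windowSum f (negℕ B) (suc (2 ℕ.* B))
  sumList-intsUpTo f B = trans (sumList-map f _ (upTo (suc (2 ℕ.* B)))) (trans (sumList-applyUpTo _ id (suc (2 ℕ.* B)))
    (sumBelow-cong (suc (2 ℕ.* B)) (λ k _ → cong f (ℤP.+-comm (+ k) (negℕ B)))))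

  windowSum-symmetric : ∀ f X → windowSum f (negℕ X) (suc (2 ℕ.* X)) ≡ f (+ 0) ℕ.+ sumTo (f ∘ +_) X ℕ.+ sumTo (f ∘ negℕ) X
  windowSum-symmetric f zero = trans (ℕP.+-identityʳ _) (trans (cong f (ℤP.+-identityʳ (+ 0))) (sym (trans (ℕP.+-identityʳ _) (ℕP.+-identityʳ _))))
  windowSum-symmetric f (suc X) = begin
      windowSum f (negℕ (suc X)) (suc (2 ℕ.* suc X))
    ≡⟨ cong (windowSum f (negℕ (suc X))) e2 ⟩
      windowSum f (negℕ (suc X)) (suc (suc (2 ℕ.* X)) ℕ.+ 1)
    ≡⟨ windowSum-split f (negℕ (suc X)) (suc (suc (2 ℕ.* X))) 1 ⟩
      windowSum f (negℕ (suc X)) (suc (suc (2 ℕ.* X))) ℕ.+ windowSum f (negℕ (suc X) ℤ.+ + suc (suc (2 ℕ.* X))) 1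
    ≡⟨ cong₂ ℕ._+_ (windowSum-suc f (negℕ (suc X)) (suc (2 ℕ.* X))) (trans (ℕP.+-identityʳ _) (cong f e3)) ⟩
      f (negℕ (suc X)) ℕ.+ windowSum f (negℕ (suc X) ℤ.+ + 1) (suc (2 ℕ.* X)) ℕ.+ f (+ suc X)
    ≡⟨ cong (λ z → f (negℕ (suc X)) ℕ.+ windowSum f z (suc (2 ℕ.* X)) ℕ.+ f (+ suc X)) e1 ⟩
      f (negℕ (suc X)) ℕ.+ windowSum f (negℕ X) (suc (2 ℕ.* X)) ℕ.+ f (+ suc X)
    ≡⟨ cong (λ z → f (negℕ (suc X)) ℕ.+ z ℕ.+ f (+ suc X)) (windowSum-symmetric f X) ⟩
      f (negℕ (suc X)) ℕ.+ (f (+ 0) ℕ.+ sumTo (f ∘ +_) X ℕ.+ sumTo (f ∘ negℕ) X) ℕ.+ f (+ suc X)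
    ≡⟨ rearr (f (negℕ (suc X))) (f (+ 0)) (sumTo (f ∘ +_) X) (sumTo (f ∘ negℕ) X) (f (+ suc X)) ⟩
      f (+ 0) ℕ.+ (sumTo (f ∘ +_) X ℕ.+ f (+ suc X)) ℕ.+ (sumTo (f ∘ negℕ) X ℕ.+ f (negℕ (suc X)))
    ≡⟨ sym (cong₂ (λ a b → f (+ 0) ℕ.+ a ℕ.+ b) (sumBelow-snoc _ X) (sumBelow-snoc _ X)) ⟩
      f (+ 0) ℕ.+ sumTo (f ∘ +_) (suc X) ℕ.+ sumTo (f ∘ negℕ) (suc X)
    ∎
    where
    open ≡-Reasoning
    e1 : negℕ (suc X) ℤ.+ + 1 ≡ negℕ X
    e1 = ℤ-solve-∀′ (+ X)
      where
      ℤ-solve-∀′ : ∀ x → ℤ.- (+ 1 ℤ.+ x) ℤ.+ + 1 ≡ ℤ.- x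
      ℤ-solve-∀′ = ℤ-solve-∀
    e2 : suc (2 ℕ.* suc X) ≡ suc (suc (2 ℕ.* X)) ℕ.+ 1
    e2 = solve-∀′ X
      where
      solve-∀′ : ∀ X → suc (2 ℕ.* suc X) ≡ suc (suc (2 ℕ.* X)) ℕ.+ 1
      solve-∀′ = solve-∀
    e3 : negℕ (suc X) ℤ.+ + suc (suc (2 ℕ.* X)) ℤ.+ + 0 ≡ + suc X
    e3 = begin
        negℕ (suc X) ℤ.+ + suc (suc (2 ℕ.* X)) ℤ.+ + 0
      ≡⟨ cong (λ z → negℕ (suc X) ℤ.+ z ℤ.+ + 0) (trans (ℤP.pos-+ 2 (2 ℕ.* X)) (cong (λ z → + 2 ℤ.+ z) (ℤP.pos-* 2 X))) ⟩
        negℕ (suc X) ℤ.+ (+ 2 ℤ.+ + 2 ℤ.* + X) ℤ.+ + 0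
      ≡⟨ ℤ-solve-∀′ (+ X) ⟩
        + 1 ℤ.+ + X
      ∎
      where
      ℤ-solve-∀′ : ∀ x → ℤ.- (+ 1 ℤ.+ x) ℤ.+ (+ 2 ℤ.+ + 2 ℤ.* x) ℤ.+ + 0 ≡ + 1 ℤ.+ x
      ℤ-solve-∀′ = ℤ-solve-∀
    rearr : ∀ a b c e g → a ℕ.+ (b ℕ.+ c ℕ.+ e) ℕ.+ g ≡ b ℕ.+ (c ℕ.+ g) ℕ.+ (e ℕ.+ a)
    rearr = solve-∀

  𝟙-∣-abs : ∀ k z → 𝟙 (k ZD.∣? z) ≡ 𝟙 (ℤ.∣ k ∣ ND.∣? ℤ.∣ z ∣)
  𝟙-∣-abs k z = 𝟙-cong (k ZD.∣? z) (ℤ.∣ k ∣ ND.∣? ℤ.∣ z ∣) ZD.∣⇒∣ᵤ ZD.∣ᵤ⇒∣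

  module MultiplesInWindow (q : ℕ) .{{_ : NonZero q}} where
    𝟙q∣ : ℤ → ℕ
    𝟙q∣ z = 𝟙 (+ q ZD.∣? z)

    𝟙q∣-periodic : ∀ z → 𝟙q∣ (z ℤ.+ + q) ≡ 𝟙q∣ z
    𝟙q∣-periodic z = 𝟙-cong (+ q ZD.∣? _) (+ q ZD.∣? z) (λ h → ZD.∣m+n∣n⇒∣m h ZD.∣-refl) (λ h → ZD.∣m∣n⇒∣m+n h ZD.∣-refl)

    q' : ℕ
    q' = q ℕ.∸ 1

    q≡ : q ≡ suc q'
    q≡ = sym (ℕP.suc-pred q)

    windowSum-shift1 : ∀ a → windowSum 𝟙q∣ (a ℤ.+ + 1) q ≡ windowSum 𝟙q∣ a q
    windowSum-shift1 a = begin
        windowSum 𝟙q∣ (a ℤ.+ + 1) q ≡⟨ cong (windowSum 𝟙q∣ (a ℤ.+ + 1)) q≡ ⟩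
        windowSum 𝟙q∣ (a ℤ.+ + 1) (suc q') ≡⟨ windowSum-snoc 𝟙q∣ (a ℤ.+ + 1) q' ⟩
        windowSum 𝟙q∣ (a ℤ.+ + 1) q' ℕ.+ 𝟙q∣ (a ℤ.+ + 1 ℤ.+ + q') ≡⟨ cong (windowSum 𝟙q∣ (a ℤ.+ + 1) q' ℕ.+_) (trans (cong 𝟙q∣ e) (𝟙q∣-periodic a)) ⟩
        windowSum 𝟙q∣ (a ℤ.+ + 1) q' ℕ.+ 𝟙q∣ a ≡⟨ ℕP.+-comm _ (𝟙q∣ a) ⟩
        𝟙q∣ a ℕ.+ windowSum 𝟙q∣ (a ℤ.+ + 1) q' ≡⟨ sym (windowSum-suc 𝟙q∣ a q') ⟩
        windowSum 𝟙q∣ a (suc q') ≡⟨ cong (windowSum 𝟙q∣ a) (sym q≡) ⟩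
        windowSum 𝟙q∣ a q ∎
      where
      open ≡-Reasoning
      e : a ℤ.+ + 1 ℤ.+ + q' ≡ a ℤ.+ + q
      e = trans (ℤP.+-assoc a (+ 1) (+ q')) (cong (λ z → a ℤ.+ z) (cong +_ (sym q≡)))

    windowSum-shift-invariant : ∀ a → windowSum 𝟙q∣ a q ≡ windowSum 𝟙q∣ (+ 0) q
    windowSum-shift-invariant (+ zero) = refl
    windowSum-shift-invariant (+ suc n) = trans (cong (λ z → windowSum 𝟙q∣ z q) (sym (trans (ℤP.pos-+ n 1) (cong +_ (ℕP.+-comm n 1))))) (trans (windowSum-shift1 (+ n)) (windowSum-shift-invariant (+ n)))
    windowSum-shift-invariant -[1+ zero ] = sym (windowSum-shift1 -[1+ zero ])
    windowSum-shift-invariant -[1+ suc n ] = trans (sym (windowSum-shift1 -[1+ suc n ])) (windowSum-shift-invariant -[1+ n ])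

    windowSum-origin : windowSum 𝟙q∣ (+ 0) q ≡ 1
    windowSum-origin = trans (cong (windowSum 𝟙q∣ (+ 0)) q≡) (trans (windowSum-suc 𝟙q∣ (+ 0) q') (cong₂ ℕ._+_ (𝟙-yes (+ q ZD.∣? + 0) (ZD.divides (+ 0) refl))
           (sumBelow-zero _ q' (λ k k<q' → 𝟙-no (+ q ZD.∣? _) (λ h → ¬small k k<q' (ZD.∣⇒∣ᵤ h))))))
      where
      ¬small : ∀ k → k ℕ.< q' → ¬ (q ND.∣ ℤ.∣ + 0 ℤ.+ + 1 ℤ.+ + k ∣)
      ¬small k k<q' h = ℕP.<⇒≱ (subst (ℕ._< q) (sym (cong ℤ.∣_∣ (trans (ℤP.+-identityˡ (+ 1 ℤ.+ + k)) (sym (ℤP.pos-+ 1 k))))) (subst (suc k ℕ.<_) (sym q≡) (ℕ.s≤s k<q')))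
        (ND.∣⇒≤ {{_}} (subst (λ z → q ND.∣ ℤ.∣ z ∣) (trans (ℤP.+-assoc (+ 0) (+ 1) (+ k)) refl) h))

    windowSum-period : ∀ a → windowSum 𝟙q∣ a q ≡ 1
    windowSum-period a = trans (windowSum-shift-invariant a) windowSum-origin

    windowSum-blocks : ∀ t r a → r ℕ.≤ q → t ℕ.≤ windowSum 𝟙q∣ a (t ℕ.* q ℕ.+ r) × windowSum 𝟙q∣ a (t ℕ.* q ℕ.+ r) ℕ.≤ suc t
    windowSum-blocks zero r a r≤q = ℕ.z≤n , ℕP.≤-trans (sumBelow-prefix _ r q r≤q) (ℕP.≤-reflexive (windowSum-period a))
    windowSum-blocks (suc t) r a r≤q = subst (λ z → suc t ℕ.≤ z × z ℕ.≤ suc (suc t)) (sym eq) (ℕ.s≤s (proj₁ ih) , ℕ.s≤s (proj₂ ih))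
      where
      ih = windowSum-blocks t r (a ℤ.+ + q) r≤q
      eq : windowSum 𝟙q∣ a (suc t ℕ.* q ℕ.+ r) ≡ suc (windowSum 𝟙q∣ (a ℤ.+ + q) (t ℕ.* q ℕ.+ r))
      eq = trans (cong (windowSum 𝟙q∣ a) (ℕP.+-assoc q (t ℕ.* q) r)) (trans (windowSum-split 𝟙q∣ a q _) (cong (ℕ._+ windowSum 𝟙q∣ (a ℤ.+ + q) (t ℕ.* q ℕ.+ r)) (windowSum-period a)))

    windowSum-bounds : ∀ a n → (q ℕ.* windowSum 𝟙q∣ a n ℕ.≤ n ℕ.+ q) × (n ℕ.≤ q ℕ.* windowSum 𝟙q∣ a n ℕ.+ q)
    windowSum-bounds a n = subst P (sym ndec) (up , lo)
      where
      t = n / q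
      r = n % q
      ndec : n ≡ t ℕ.* q ℕ.+ r
      ndec = trans (DM.m≡m%n+[m/n]*n n q) (ℕP.+-comm r _)
      P : ℕ → Set
      P m = (q ℕ.* windowSum 𝟙q∣ a m ℕ.≤ m ℕ.+ q) × (m ℕ.≤ q ℕ.* windowSum 𝟙q∣ a m ℕ.+ q)
      c = windowSum-blocks t r a (ℕP.<⇒≤ (DM.m%n<n n q))
      Sv = windowSum 𝟙q∣ a (t ℕ.* q ℕ.+ r)
      up : q ℕ.* Sv ℕ.≤ t ℕ.* q ℕ.+ r ℕ.+ q
      up = begin
        q ℕ.* Sv ≤⟨ ℕP.*-monoʳ-≤ q (proj₂ c) ⟩
        q ℕ.* suc t ≡⟨ ℕP.*-comm q (suc t) ⟩
        q ℕ.+ t ℕ.* q ≡⟨ ℕP.+-comm q _ ⟩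
        t ℕ.* q ℕ.+ q ≤⟨ ℕP.+-monoˡ-≤ q (ℕP.m≤m+n (t ℕ.* q) r) ⟩
        t ℕ.* q ℕ.+ r ℕ.+ q ∎
        where open ℕP.≤-Reasoning
      lo : t ℕ.* q ℕ.+ r ℕ.≤ q ℕ.* Sv ℕ.+ q
      lo = ℕP.+-mono-≤ (subst (ℕ._≤ q ℕ.* Sv) (ℕP.*-comm q t) (ℕP.*-monoʳ-≤ q (proj₁ c))) (ℕP.<⇒≤ (DM.m%n<n n q))

  sumList-restrict : ∀ (g : ℤ → ℕ) K B → K ℕ.≤ B →
    sumList (λ x → 𝟙 (ℤ.∣ x ∣ ℕP.≤? K) ℕ.* g x) (intsUpTo B) ≡ windowSum g (negℕ K) (suc (2 ℕ.* K))
  sumList-restrict g K B K≤B = trans (sumList-intsUpTo h B) (trans (windowSum-symmetric h B) (trans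
      (cong₂ ℕ._+_ (cong₂ ℕ._+_ (ℕP.+-identityʳ (g (+ 0))) (sumTo-truncate (g ∘ +_) (h ∘ +_) K B K≤B (λ b b≤K → in1 (+ b) b≤K) (λ b K<b → in0 (+ b) K<b)))
         (sumTo-truncate (g ∘ negℕ) (h ∘ negℕ) K B K≤B (λ b b≤K → in1 (negℕ b) (subst (ℕ._≤ K) (sym (ℤP.∣-i∣≡∣i∣ (+ b))) b≤K)) (λ b K<b → in0 (negℕ b) (subst (K ℕ.<_) (sym (ℤP.∣-i∣≡∣i∣ (+ b))) K<b))))
      (sym (windowSum-symmetric g K))))
    where
    h : ℤ → ℕ
    h x = 𝟙 (ℤ.∣ x ∣ ℕP.≤? K) ℕ.* g x
    in1 : ∀ x → ℤ.∣ x ∣ ℕ.≤ K → h x ≡ g x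
    in1 x le = trans (cong (ℕ._* g x) (𝟙-yes (ℤ.∣ x ∣ ℕP.≤? K) le)) (ℕP.*-identityˡ (g x))
    in0 : ∀ x → K ℕ.< ℤ.∣ x ∣ → h x ≡ 0
    in0 x lt = cong (ℕ._* g x) (𝟙-no (ℤ.∣ x ∣ ℕP.≤? K) (ℕP.<⇒≱ lt))

  windowSum-multiples : ∀ (f : ℤ → ℕ) s .{{_ : NonZero s}} K →
    windowSum (λ x → 𝟙 (+ s ZD.∣? x) ℕ.* f x) (negℕ K) (suc (2 ℕ.* K)) ≡ windowSum (λ y → f (y ℤ.* + s)) (negℕ (K / s)) (suc (2 ℕ.* (K / s)))
  windowSum-multiples f s K = trans (windowSum-symmetric h K) (trans (cong₂ ℕ._+_ (cong₂ ℕ._+_ h0 pos) neg) (sym (windowSum-symmetric (λ y → f (y ℤ.* + s)) (K / s))))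
    where
    h : ℤ → ℕ
    h x = 𝟙 (+ s ZD.∣? x) ℕ.* f x
    h0 : h (+ 0) ≡ f (+ 0 ℤ.* + s)
    h0 = trans (cong (ℕ._* f (+ 0)) (𝟙-yes (+ s ZD.∣? + 0) (ZD.divides (+ 0) refl))) (trans (ℕP.*-identityˡ _) (cong f (sym (ℤP.*-zeroˡ (+ s)))))
    pos : sumTo (h ∘ +_) K ≡ sumTo (λ c → f (+ c ℤ.* + s)) (K / s)
    pos = trans (sumTo-cong K (λ b → cong (ℕ._* f (+ b)) (𝟙-∣-abs (+ s) (+ b))))
          (trans (sumTo-multiples s (f ∘ +_) K) (sumTo-cong (K / s) (λ c → cong f (trans (ℤP.pos-* s c) (ℤP.*-comm (+ s) (+ c))))))
    neg : sumTo (h ∘ negℕ) K ≡ sumTo (λ c → f (negℕ c ℤ.* + s)) (K / s)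
    neg = trans (sumTo-cong K (λ b → cong (ℕ._* f (negℕ b)) (trans (𝟙-∣-abs (+ s) (negℕ b)) (cong (λ z → 𝟙 (s ND.∣? z)) (ℤP.∣-i∣≡∣i∣ (+ b))))))
          (trans (sumTo-multiples s (f ∘ negℕ) K) (sumTo-cong (K / s) (λ c → cong f (trans (cong ℤ.-_ (trans (ℤP.pos-* s c) (ℤP.*-comm (+ s) (+ c)))) (ℤP.neg-distribˡ-* (+ c) (+ s))))))


module Coordinates where

  open FiniteSums
  open Sieve
  open SieveDensity
  open IntegerWindows
  open import Defs
  open import Data.Nat as ℕ using (ℕ; zero; suc; NonZero)
  import Data.Nat.Properties as ℕP
  import Algebra.Properties.CommutativeSemigroup ℕP.*-commutativeSemigroup as *-CS
  open import Data.Nat.Tactic.RingSolver using (solve-∀)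
  import Data.Nat.Divisibility as ND
  import Data.Nat.DivMod as DM
  open import Data.Nat.Coprimality as NC using (Coprime; coprime?)
  open import Data.Nat.Primality using (Prime; prime⇒nonZero)
  open import Data.Empty using (⊥; ⊥-elim)
  open import Data.Integer as ℤ using (ℤ; +_; -[1+_])
  import Data.Integer.Properties as ℤP
  import Data.Integer.Divisibility.Signed as ZD
  open import Data.Integer.Divisibility.Signed using (_∣?_)
  import Data.Integer.DivMod as ZDM
  open import Data.Integer.DivMod using (_/_)
  open import Data.Integer.GCD using (gcd)
  open import Data.Integer.Tactic.RingSolver using () renaming (solve-∀ to ℤ-solve-∀)
  open import Data.Rational as ℚ using (ℚ)
  open import Data.Fin using (Fin; toℕ; zero; suc)
  open import Data.Fin.Properties using (all?)
  open import Data.Vec using (Vec; []; _∷_; lookup)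
  open import Data.List using (List; []; _∷_; [_])
  open import Data.Product using (_×_; _,_; proj₁; proj₂)
  open import Function using (_∘_)
  open import Relation.Nullary using (Dec; yes; no; contradiction)
  open import Relation.Nullary.Decidable using (¬?; _×-dec_; _→-dec_)
  open import Relation.Binary.PropositionalEquality

  prodFin : ∀ n → (Fin n → ℕ) → ℕ
  prodFin zero f = 1
  prodFin (suc n) f = f zero ℕ.* prodFin n (f ∘ suc)

  prodFin-cong : ∀ n {f g : Fin n → ℕ} → (∀ i → f i ≡ g i) → prodFin n f ≡ prodFin n g
  prodFin-cong zero e = refl
  prodFin-cong (suc n) e = cong₂ ℕ._*_ (e zero) (prodFin-cong n (e ∘ suc))

  prodFin-* : ∀ n (f g : Fin n → ℕ) → prodFin n (λ i → f i ℕ.* g i) ≡ prodFin n f ℕ.* prodFin n g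
  prodFin-* zero f g = refl
  prodFin-* (suc n) f g = trans (cong (f zero ℕ.* g zero ℕ.*_) (prodFin-* n (f ∘ suc) (g ∘ suc))) (*-CS.interchange (f zero) (g zero) (prodFin n (f ∘ suc)) (prodFin n (g ∘ suc)))

  𝟙-all : ∀ n {P : Fin n → Set} (P? : ∀ i → Dec (P i)) → 𝟙 (all? P?) ≡ prodFin n (λ i → 𝟙 (P? i))
  𝟙-all zero P? = 𝟙-yes (all? P?) (λ ())
  𝟙-all (suc n) P? = trans (𝟙-cong (all? P?) (P? zero ×-dec all? (P? ∘ suc)) (λ f → f zero , f ∘ suc) (λ { (a , f) zero → a ; (a , f) (suc i) → f i }))
    (trans (𝟙-× (P? zero) (all? (P? ∘ suc))) (cong (𝟙 (P? zero) ℕ.*_) (𝟙-all n (P? ∘ suc))))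

  sumList-vecsOf-suc : ∀ n (xs : List ℤ) (F : Vec ℤ (suc n) → ℕ) →
    sumList F (vecsOf (suc n) xs) ≡ sumList (λ x → sumList (λ v → F (x ∷ v)) (vecsOf n xs)) xs
  sumList-vecsOf-suc n xs F = trans (sumList-concatMap F _ xs) (sumList-cong xs (λ x → sumList-map F (x ∷_) (vecsOf n xs)))

  module CoordinateWeights (m s : ℕ) .{{_ : NonZero s}} (K : ℕ) where
    d : ℕ
    d = suc (suc (suc m))

    𝟙≤K 𝟙s∣ 𝟙d∣ 𝟙d²∣ : ℤ → ℕ
    𝟙≤K x = 𝟙 (ℤ.∣ x ∣ ℕP.≤? K)
    𝟙s∣ x = 𝟙 (+ s ∣? x)
    𝟙d∣ x = 𝟙 (+ d ∣? x)
    𝟙d²∣ x = 𝟙 (+ (d ℕ.* d) ∣? x)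

    firstWeight middleWeight : ℤ → ℕ
    firstWeight x = 𝟙≤K x ℕ.* (𝟙s∣ x ℕ.* (𝟙 (gcd (x / + s) (+ s) ℤP.≟ + 1) ℕ.* (𝟙d∣ x ℕ.* 𝟙 (¬? (+ (d ℕ.* d) ∣? x)))))
    middleWeight x = 𝟙≤K x ℕ.* (𝟙s∣ x ℕ.* (𝟙d∣ x ℕ.* 𝟙d²∣ x))

    lastWeight : ℤ → ℤ → ℕ
    lastWeight a0 x = 𝟙≤K x ℕ.* (𝟙s∣ x ℕ.* (𝟙d∣ x ℕ.* 𝟙d²∣ (a0 ℤ.+ x)))

    tailWeight : ∀ {k} → ℤ → Vec ℤ (suc k) → ℕ
    tailWeight a0 (x ∷ []) = lastWeight a0 x
    tailWeight a0 (x ∷ y ∷ v) = middleWeight x ℕ.* tailWeight a0 (y ∷ v)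

    boxWeight : ℤ → ℕ
    boxWeight x = 𝟙≤K x ℕ.* (𝟙s∣ x ℕ.* 𝟙d∣ x)

    middleCondition : ∀ {k} → Vec ℤ (suc k) → Fin (suc k) → ℕ
    middleCondition {k} t j = 𝟙 ((suc (toℕ j) ℕP.≤? k) →-dec (+ (d ℕ.* d) ∣? lookup t j))

    tailWeight-factor : ∀ k (t : Vec ℤ (suc k)) a0 → prodFin (suc k) (boxWeight ∘ lookup t) ℕ.* (prodFin (suc k) (middleCondition t) ℕ.* 𝟙d²∣ (a0 ℤ.+ coeff t k)) ≡ tailWeight a0 t
    tailWeight-factor zero (x ∷ []) a0 = trans (cong₂ (λ u v → u ℕ.* (v ℕ.* 𝟙d²∣ (a0 ℤ.+ x))) (ℕP.*-identityʳ (boxWeight x))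
         (trans (ℕP.*-identityʳ _) (𝟙-yes ((1 ℕP.≤? 0) →-dec (+ (d ℕ.* d) ∣? x)) (λ ()))))
        (trans (cong (boxWeight x ℕ.*_) (ℕP.*-identityˡ _)) (trans (ℕP.*-assoc (𝟙≤K x) _ _) (cong (𝟙≤K x ℕ.*_) (ℕP.*-assoc (𝟙s∣ x) (𝟙d∣ x) _))))
    tailWeight-factor (suc k) (x ∷ t@(y ∷ v)) a0 = begin
        (boxWeight x ℕ.* prodFin (suc k) (boxWeight ∘ lookup t)) ℕ.* (middleCondition (x ∷ t) zero ℕ.* prodFin (suc k) (middleCondition (x ∷ t) ∘ suc) ℕ.* 𝟙d²∣ (a0 ℤ.+ coeff t k))
      ≡⟨ cong₂ (λ u v → (boxWeight x ℕ.* prodFin (suc k) (boxWeight ∘ lookup t)) ℕ.* (u ℕ.* v ℕ.* 𝟙d²∣ (a0 ℤ.+ coeff t k)))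
           (𝟙-cong ((1 ℕP.≤? suc k) →-dec (+ (d ℕ.* d) ∣? x)) (+ (d ℕ.* d) ∣? x) (λ f → f (ℕ.s≤s ℕ.z≤n)) (λ h _ → h))
           (prodFin-cong (suc k) (λ j → 𝟙-cong ((suc (suc (toℕ j)) ℕP.≤? suc k) →-dec (+ (d ℕ.* d) ∣? lookup t j)) ((suc (toℕ j) ℕP.≤? k) →-dec (+ (d ℕ.* d) ∣? lookup t j))
                (λ f le → f (ℕ.s≤s le)) (λ f le → f (ℕP.≤-pred le)))) ⟩
        (boxWeight x ℕ.* prodFin (suc k) (boxWeight ∘ lookup t)) ℕ.* (𝟙d²∣ x ℕ.* prodFin (suc k) (middleCondition t) ℕ.* 𝟙d²∣ (a0 ℤ.+ coeff t k))
      ≡⟨ shuffle (𝟙≤K x) (𝟙s∣ x) (𝟙d∣ x) (𝟙d²∣ x) (prodFin (suc k) (boxWeight ∘ lookup t)) (prodFin (suc k) (middleCondition t)) (𝟙d²∣ (a0 ℤ.+ coeff t k)) ⟩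
        middleWeight x ℕ.* (prodFin (suc k) (boxWeight ∘ lookup t) ℕ.* (prodFin (suc k) (middleCondition t) ℕ.* 𝟙d²∣ (a0 ℤ.+ coeff t k)))
      ≡⟨ cong (middleWeight x ℕ.*_) (tailWeight-factor k t a0) ⟩
        middleWeight x ℕ.* tailWeight a0 t
      ∎
      where
      open ≡-Reasoning
      shuffle : ∀ a b c e p q r → (a ℕ.* (b ℕ.* c) ℕ.* p) ℕ.* (e ℕ.* q ℕ.* r) ≡ (a ℕ.* (b ℕ.* (c ℕ.* e))) ℕ.* (p ℕ.* (q ℕ.* r))
      shuffle = solve-∀

    𝟙-inG' : (H : ℚ) → (∀ n → (ℕtoℚ n ℚ.≤ H → n ℕ.≤ K) × (n ℕ.≤ K → ℕtoℚ n ℚ.≤ H)) →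
      ∀ a0 (t : Vec ℤ (suc (suc m))) → 𝟙 (inG'? d s H (a0 ∷ t)) ≡ firstWeight a0 ℕ.* tailWeight a0 t
    𝟙-inG' H ≤H⇔≤K a0 t = begin
        𝟙 (inG'? d s H a)
      ≡⟨ 𝟙-×₇ D1 D2 D3 D4 D5 D6 D7 ⟩
        𝟙 D1 ℕ.* (𝟙 D2 ℕ.* (𝟙 D3 ℕ.* (𝟙 D4 ℕ.* (𝟙 D5 ℕ.* (𝟙 D6 ℕ.* 𝟙 D7)))))
      ≡⟨ cong₂ (λ u v → u ℕ.* (v ℕ.* (𝟙 D3 ℕ.* (𝟙 D4 ℕ.* (𝟙 D5 ℕ.* (𝟙 D6 ℕ.* 𝟙 D7)))))) I1 (𝟙-all d (λ i → (+ s) ∣? lookup a i)) ⟩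
        (𝟙≤K a0 ℕ.* PK) ℕ.* ((𝟙s∣ a0 ℕ.* Ps) ℕ.* (𝟙 D3 ℕ.* (𝟙 D4 ℕ.* (𝟙 D5 ℕ.* (𝟙 D6 ℕ.* 𝟙 D7)))))
      ≡⟨ cong₂ (λ u v → (𝟙≤K a0 ℕ.* PK) ℕ.* ((𝟙s∣ a0 ℕ.* Ps) ℕ.* (𝟙 D3 ℕ.* (u ℕ.* (𝟙 D5 ℕ.* (v ℕ.* 𝟙 D7)))))) (𝟙-all d (λ i → (+ d) ∣? lookup a i)) I6 ⟩
        (𝟙≤K a0 ℕ.* PK) ℕ.* ((𝟙s∣ a0 ℕ.* Ps) ℕ.* (𝟙 D3 ℕ.* ((𝟙d∣ a0 ℕ.* Pd) ℕ.* (𝟙 D5 ℕ.* ((1 ℕ.* prodFin (suc (suc m)) (middleCondition t)) ℕ.* 𝟙 D7)))))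
      ≡⟨ shuffle (𝟙≤K a0) PK (𝟙s∣ a0) Ps (𝟙 D3) (𝟙d∣ a0) Pd (𝟙 D5) (prodFin (suc (suc m)) (middleCondition t)) (𝟙 D7) ⟩
        firstWeight a0 ℕ.* ((PK ℕ.* (Ps ℕ.* Pd)) ℕ.* (prodFin (suc (suc m)) (middleCondition t) ℕ.* 𝟙 D7))
      ≡⟨ cong (λ u → firstWeight a0 ℕ.* (u ℕ.* (prodFin (suc (suc m)) (middleCondition t) ℕ.* 𝟙 D7))) (sym (trans (prodFin-* (suc (suc m)) (𝟙≤K ∘ lookup t) (λ i → 𝟙s∣ (lookup t i) ℕ.* 𝟙d∣ (lookup t i))) (cong (PK ℕ.*_) (prodFin-* (suc (suc m)) (𝟙s∣ ∘ lookup t) (𝟙d∣ ∘ lookup t))))) ⟩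
        firstWeight a0 ℕ.* (prodFin (suc (suc m)) (boxWeight ∘ lookup t) ℕ.* (prodFin (suc (suc m)) (middleCondition t) ℕ.* 𝟙d²∣ (a0 ℤ.+ coeff t (suc m))))
      ≡⟨ cong (firstWeight a0 ℕ.*_) (tailWeight-factor (suc m) t a0) ⟩
        firstWeight a0 ℕ.* tailWeight a0 t
      ∎
      where
      open ≡-Reasoning
      shuffle : ∀ a b c e g h i j l n → (a ℕ.* b) ℕ.* ((c ℕ.* e) ℕ.* (g ℕ.* ((h ℕ.* i) ℕ.* (j ℕ.* ((1 ℕ.* l) ℕ.* n)))))
        ≡ (a ℕ.* (c ℕ.* (g ℕ.* (h ℕ.* j)))) ℕ.* ((b ℕ.* (e ℕ.* i)) ℕ.* (l ℕ.* n))
      shuffle = solve-∀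
      a : Vec ℤ d
      a = a0 ∷ t
      D1 = heightLE? H a
      D2 = all? (λ i → (+ s) ∣? lookup a i)
      D3 = gcd (coeff a 0 / (+ s)) (+ s) ℤP.≟ + 1
      D4 = all? (λ i → (+ d) ∣? lookup a i)
      D5 = ¬? ((+ (d ℕ.* d)) ∣? coeff a 0)
      D6 = all? (λ i → (1 ℕ.≤? toℕ i) →-dec ((toℕ i ℕ.≤? d ℕ.∸ 2) →-dec ((+ (d ℕ.* d)) ∣? lookup a i)))
      D7 = ((+ (d ℕ.* d)) ∣? (coeff a 0 ℤ.+ coeff a (d ℕ.∸ 1)))
      PK = prodFin (suc (suc m)) (𝟙≤K ∘ lookup t)
      Ps = prodFin (suc (suc m)) (𝟙s∣ ∘ lookup t)
      Pd = prodFin (suc (suc m)) (𝟙d∣ ∘ lookup t)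
      I1 : 𝟙 D1 ≡ 𝟙≤K a0 ℕ.* PK
      I1 = trans (𝟙-all d (λ i → ℕtoℚ ℤ.∣ lookup a i ∣ ℚ.≤? H)) (prodFin-cong d (λ i → 𝟙-cong (ℕtoℚ ℤ.∣ lookup a i ∣ ℚ.≤? H) (ℤ.∣ lookup a i ∣ ℕP.≤? K) (proj₁ (≤H⇔≤K _)) (proj₂ (≤H⇔≤K _))))
      I6 : 𝟙 D6 ≡ 1 ℕ.* prodFin (suc (suc m)) (middleCondition t)
      I6 = trans (𝟙-all d (λ i → (1 ℕ.≤? toℕ i) →-dec ((toℕ i ℕ.≤? d ℕ.∸ 2) →-dec ((+ (d ℕ.* d)) ∣? lookup a i)))) (cong₂ ℕ._*_ (𝟙-yes ((1 ℕ.≤? 0) →-dec ((0 ℕ.≤? suc (suc (suc m)) ℕ.∸ 2) →-dec ((+ (d ℕ.* d)) ∣? a0))) (λ ()))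
        (prodFin-cong (suc (suc m)) (λ j → 𝟙-cong ((1 ℕ.≤? suc (toℕ j)) →-dec ((suc (toℕ j) ℕ.≤? suc m) →-dec ((+ (d ℕ.* d)) ∣? lookup t j)))
           ((suc (toℕ j) ℕP.≤? suc m) →-dec ((+ (d ℕ.* d)) ∣? lookup t j)) (λ f → f (ℕ.s≤s ℕ.z≤n)) (λ f _ → f))))

    tailWeight-∷ : ∀ {k} a0 x (v : Vec ℤ (suc k)) → tailWeight a0 (x ∷ v) ≡ middleWeight x ℕ.* tailWeight a0 v
    tailWeight-∷ a0 x (y ∷ v) = refl

    sumList-tailWeight : ∀ (xs : List ℤ) k a0 → sumList (tailWeight a0) (vecsOf (suc k) xs) ≡ sumList middleWeight xs ℕ.^ k ℕ.* sumList (lastWeight a0) xs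
    sumList-tailWeight xs zero a0 = trans (sumList-vecsOf-suc 0 xs (tailWeight a0)) (trans (sumList-cong xs (λ x → ℕP.+-identityʳ (lastWeight a0 x))) (sym (ℕP.*-identityˡ _)))
    sumList-tailWeight xs (suc k) a0 = begin
        sumList (tailWeight a0) (vecsOf (suc (suc k)) xs)
      ≡⟨ sumList-vecsOf-suc (suc k) xs (tailWeight a0) ⟩
        sumList (λ x → sumList (λ v → tailWeight a0 (x ∷ v)) (vecsOf (suc k) xs)) xs
      ≡⟨ sumList-cong xs (λ x → trans (sumList-cong (vecsOf (suc k) xs) (tailWeight-∷ a0 x)) (trans (sumList-*ˡ (middleWeight x) (tailWeight a0) (vecsOf (suc k) xs)) (cong (middleWeight x ℕ.*_) (sumList-tailWeight xs k a0)))) ⟩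
        sumList (λ x → middleWeight x ℕ.* (sumList middleWeight xs ℕ.^ k ℕ.* sumList (lastWeight a0) xs)) xs
      ≡⟨ sumList-*ʳ _ middleWeight xs ⟩
        sumList middleWeight xs ℕ.* (sumList middleWeight xs ℕ.^ k ℕ.* sumList (lastWeight a0) xs)
      ≡⟨ sym (ℕP.*-assoc (sumList middleWeight xs) _ _) ⟩
        sumList middleWeight xs ℕ.^ suc k ℕ.* sumList (lastWeight a0) xs
      ∎
      where open ≡-Reasoning

    countG'-factorisation : (H : ℚ) → (∀ n → (ℕtoℚ n ℚ.≤ H → n ℕ.≤ K) × (n ℕ.≤ K → ℕtoℚ n ℚ.≤ H)) →
      countG' d s H ≡ sumList middleWeight (intsUpTo ℤ.∣ ℚ.ceiling H ∣) ℕ.^ suc m ℕ.* sumList (λ a0 → firstWeight a0 ℕ.* sumList (lastWeight a0) (intsUpTo ℤ.∣ ℚ.ceiling H ∣)) (intsUpTo ℤ.∣ ℚ.ceiling H ∣)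
    countG'-factorisation H ≤H⇔≤K = begin
        countG' d s H
      ≡⟨ length-filter≡sumList (inG'? d s H) (box d H) ⟩
        sumList (λ a → 𝟙 (inG'? d s H a)) (vecsOf d xs)
      ≡⟨ sumList-vecsOf-suc (suc (suc m)) xs (λ a → 𝟙 (inG'? d s H a)) ⟩
        sumList (λ a0 → sumList (λ t → 𝟙 (inG'? d s H (a0 ∷ t))) (vecsOf (suc (suc m)) xs)) xs
      ≡⟨ sumList-cong xs (λ a0 → trans (sumList-cong (vecsOf (suc (suc m)) xs) (𝟙-inG' H ≤H⇔≤K a0)) (trans (sumList-*ˡ (firstWeight a0) (tailWeight a0) (vecsOf (suc (suc m)) xs)) (cong (firstWeight a0 ℕ.*_) (sumList-tailWeight xs (suc m) a0)))) ⟩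
        sumList (λ a0 → firstWeight a0 ℕ.* (sumList middleWeight xs ℕ.^ suc m ℕ.* sumList (lastWeight a0) xs)) xs
      ≡⟨ sumList-cong xs (λ a0 → *-CS.x∙yz≈y∙xz (firstWeight a0) (sumList middleWeight xs ℕ.^ suc m) (sumList (lastWeight a0) xs)) ⟩
        sumList (λ a0 → sumList middleWeight xs ℕ.^ suc m ℕ.* (firstWeight a0 ℕ.* sumList (lastWeight a0) xs)) xs
      ≡⟨ sumList-*ˡ (sumList middleWeight xs ℕ.^ suc m) (λ a0 → firstWeight a0 ℕ.* sumList (lastWeight a0) xs) xs ⟩
        sumList middleWeight xs ℕ.^ suc m ℕ.* sumList (λ a0 → firstWeight a0 ℕ.* sumList (lastWeight a0) xs) xs
      ∎
      where
      open ≡-Reasoning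
      xs = intsUpTo ℤ.∣ ℚ.ceiling H ∣

  quotient-unique : ∀ y q r s → y ℤ.* + s ≡ + r ℤ.+ q ℤ.* + s → r ℕ.< s → q ≡ y
  quotient-unique y q r s eqa r<s = lem (y ℤ.- q) refl e1
    where
    distrib : ∀ y q s → (y ℤ.- q) ℤ.* s ≡ y ℤ.* s ℤ.- q ℤ.* s
    distrib = ℤ-solve-∀
    cancel : ∀ r x → r ℤ.+ x ℤ.- x ≡ r
    cancel = ℤ-solve-∀
    split : ∀ y q → y ≡ (y ℤ.- q) ℤ.+ q
    split = ℤ-solve-∀
    e1 : (y ℤ.- q) ℤ.* + s ≡ + r
    e1 = begin
        (y ℤ.- q) ℤ.* + s ≡⟨ distrib y q (+ s) ⟩
        y ℤ.* + s ℤ.- q ℤ.* + s ≡⟨ cong (λ z → z ℤ.- q ℤ.* + s) eqa ⟩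
        + r ℤ.+ q ℤ.* + s ℤ.- q ℤ.* + s ≡⟨ cancel (+ r) (q ℤ.* + s) ⟩
        + r ∎
      where open ≡-Reasoning
    lem : ∀ z → y ℤ.- q ≡ z → z ℤ.* + s ≡ + r → q ≡ y
    lem z ez e with z
    ... | + zero = sym (trans (split y q) (trans (cong (ℤ._+ q) ez) (ℤP.+-identityˡ q)))
    ... | + suc k = contradiction (ℕP.≤-trans (ℕP.m≤m+n s (k ℕ.* s)) (ℕP.≤-reflexive (ℤP.+-injective (trans (ℤP.pos-* (suc k) s) e)))) (ℕP.<⇒≱ r<s)
    ... | -[1+ k ] = ⊥-elim (negcase s r<s e)
      where
      negcase : ∀ s' → r ℕ.< s' → -[1+ k ] ℤ.* + s' ≡ + r → ⊥
      negcase (suc s') _ ()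

  [y*s]/s≡y : ∀ y s .{{_ : NonZero s}} → (y ℤ.* + s) ZDM./ + s ≡ y
  [y*s]/s≡y y s = quotient-unique y _ _ s (ZDM.a≡a%n+[a/n]*n (y ℤ.* + s) (+ s)) (ZDM.n%d<d (y ℤ.* + s) (+ s))

  module CoordinateSums (m : ℕ) (pd : Prime (suc (suc (suc m)))) (s : ℕ) .{{_ : NonZero s}} (s⊥d : Coprime s (suc (suc (suc m)))) (K : ℕ) where
    open CoordinateWeights m s K
    open SieveWeight d pd using (weight)
    open TotientDensity d pd s s⊥d using (P; weight-primeDivisors)
    open MultiplesInWindow (d ℕ.* d) {{ℕP.m*n≢0 d d {{prime⇒nonZero pd}} {{prime⇒nonZero pd}}}} using (𝟙q∣)
    dd : ℕ
    dd = d ℕ.* d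

    X : ℕ
    X = K DM./ s

    coprime-d-s : Coprime d s
    coprime-d-s = NC.sym s⊥d

    coprime-d²-s : Coprime dd s
    coprime-d²-s = NC.sym (coprime-* s⊥d s⊥d)

    𝟙-∣-*s : ∀ c → Coprime c s → ∀ y → 𝟙 (+ c ∣? (y ℤ.* + s)) ≡ 𝟙 (+ c ∣? y)
    𝟙-∣-*s c cp y = trans (𝟙-∣-abs (+ c) (y ℤ.* + s)) (trans (𝟙-cong (c ND.∣? ℤ.∣ y ℤ.* + s ∣) (c ND.∣? ℤ.∣ y ∣)
        (λ h → NC.coprime-divisor cp (subst (c ND.∣_) (trans (ℤP.abs-* y (+ s)) (ℕP.*-comm ℤ.∣ y ∣ s)) h))
        (λ h → subst (c ND.∣_) (sym (ℤP.abs-* y (+ s))) (ND.∣m⇒∣m*n s h))) (sym (𝟙-∣-abs (+ c) y)))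

    sum-middleWeight : ∀ B → K ℕ.≤ B → sumList middleWeight (intsUpTo B) ≡ windowSum 𝟙q∣ (negℕ X) (suc (2 ℕ.* X))
    sum-middleWeight B K≤B = trans (sumList-restrict (λ x → 𝟙s∣ x ℕ.* (𝟙d∣ x ℕ.* 𝟙d²∣ x)) K B K≤B) (trans (windowSum-multiples (λ x → 𝟙d∣ x ℕ.* 𝟙d²∣ x) s K)
      (windowSum-cong (negℕ X) (suc (2 ℕ.* X)) pw))
      where
      pw : ∀ y → 𝟙d∣ (y ℤ.* + s) ℕ.* 𝟙d²∣ (y ℤ.* + s) ≡ 𝟙q∣ y
      pw y = trans (cong₂ ℕ._*_ (𝟙-∣-*s d coprime-d-s y) (𝟙-∣-*s dd coprime-d²-s y)) (pw' (+ dd ∣? y))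
        where
        pw' : (h : Dec (+ dd ZD.∣ y)) → 𝟙 (+ d ∣? y) ℕ.* 𝟙 h ≡ 𝟙 h
        pw' (yes h) = trans (cong (ℕ._* 1) (𝟙-yes (+ d ∣? y) (ZD.∣-trans (ZD.∣ᵤ⇒∣ (ND.m∣m*n d)) h))) refl
        pw' (no _) = ℕP.*-zeroʳ (𝟙 (+ d ∣? y))

    𝟙-∤-*s : ∀ c → Coprime c s → ∀ y → 𝟙 (¬? (+ c ∣? (y ℤ.* + s))) ≡ 𝟙 (¬? (+ c ∣? y))
    𝟙-∤-*s c cp y = 𝟙-cong (¬? (+ c ∣? (y ℤ.* + s))) (¬? (+ c ∣? y)) (λ f h → f (bwd h)) (λ f h → f (fwd h))
      where
      fwd : + c ZD.∣ (y ℤ.* + s) → + c ZD.∣ y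
      fwd h = ZD.∣ᵤ⇒∣ (NC.coprime-divisor cp (subst (c ND.∣_) (trans (ℤP.abs-* y (+ s)) (ℕP.*-comm ℤ.∣ y ∣ s)) (ZD.∣⇒∣ᵤ h)))
      bwd : + c ZD.∣ y → + c ZD.∣ (y ℤ.* + s)
      bwd h = ZD.∣m⇒∣m*n (+ s) h

    sum-lastWeight : ∀ B → K ℕ.≤ B → ∀ b0 → + d ZD.∣ b0 → sumList (lastWeight (b0 ℤ.* + s)) (intsUpTo B) ≡ windowSum 𝟙q∣ (b0 ℤ.+ negℕ X) (suc (2 ℕ.* X))
    sum-lastWeight B K≤B b0 d∣b0 = trans (sumList-restrict (λ x → 𝟙s∣ x ℕ.* (𝟙d∣ x ℕ.* 𝟙d²∣ (b0 ℤ.* + s ℤ.+ x))) K B K≤B)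
      (trans (windowSum-multiples (λ x → 𝟙d∣ x ℕ.* 𝟙d²∣ (b0 ℤ.* + s ℤ.+ x)) s K)
        (sumBelow-cong (suc (2 ℕ.* X)) (λ k _ → trans (pw (negℕ X ℤ.+ + k)) (cong 𝟙q∣ (sym (ℤP.+-assoc b0 (negℕ X) (+ k)))))))
      where
      pw : ∀ y → 𝟙d∣ (y ℤ.* + s) ℕ.* 𝟙d²∣ (b0 ℤ.* + s ℤ.+ y ℤ.* + s) ≡ 𝟙q∣ (b0 ℤ.+ y)
      pw y = trans (cong₂ ℕ._*_ (𝟙-∣-*s d coprime-d-s y) (trans (cong 𝟙d²∣ (sym (ℤP.*-distribʳ-+ (+ s) b0 y))) (𝟙-∣-*s dd coprime-d²-s (b0 ℤ.+ y))))
         (pw' (+ dd ∣? (b0 ℤ.+ y)))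
        where
        pw' : (h : Dec (+ dd ZD.∣ (b0 ℤ.+ y))) → 𝟙 (+ d ∣? y) ℕ.* 𝟙 h ≡ 𝟙 h
        pw' (yes h) = cong (ℕ._* 1) (𝟙-yes (+ d ∣? y) (ZD.∣m+n∣m⇒∣n (ZD.∣-trans (ZD.∣ᵤ⇒∣ (ND.m∣m*n d)) h) d∣b0))
        pw' (no _) = ℕP.*-zeroʳ (𝟙 (+ d ∣? y))

    firstWeight/s : ℤ → ℕ
    firstWeight/s x = 𝟙 (gcd (x ZDM./ + s) (+ s) ℤP.≟ + 1) ℕ.* (𝟙d∣ x ℕ.* 𝟙 (¬? (+ dd ∣? x)))

    firstWeight/s≡weight : ∀ y → firstWeight/s (y ℤ.* + s) ≡ weight P ℤ.∣ y ∣
    firstWeight/s≡weight y = trans (cong₂ ℕ._*_ (trans (cong (λ z → 𝟙 (gcd z (+ s) ℤP.≟ + 1)) ([y*s]/s≡y y s))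
        (𝟙-cong (gcd y (+ s) ℤP.≟ + 1) (coprime? ℤ.∣ y ∣ s) (λ e → NC.gcd≡1⇒coprime (ℤP.+-injective e)) (λ c → cong +_ (NC.coprime⇒gcd≡1 c))))
        (cong₂ ℕ._*_ (trans (𝟙-∣-*s d coprime-d-s y) (𝟙-∣-abs (+ d) y))
           (trans (𝟙-∤-*s dd coprime-d²-s y) (𝟙-cong (¬? (+ dd ∣? y)) (¬? (dd ND.∣? ℤ.∣ y ∣)) (λ f h → f (ZD.∣ᵤ⇒∣ h)) (λ f h → f (ZD.∣⇒∣ᵤ h))))))
      (trans (*-CS.x∙yz≈y∙zx (𝟙 (coprime? ℤ.∣ y ∣ s)) (𝟙 (d ND.∣? ℤ.∣ y ∣)) (𝟙 (¬? (dd ND.∣? ℤ.∣ y ∣)))) (sym (weight-primeDivisors ℤ.∣ y ∣)))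

    sum-firstWeight : ∀ B → K ℕ.≤ B → sumList firstWeight (intsUpTo B) ≡ sumTo (weight P) X ℕ.+ sumTo (weight P) X
    sum-firstWeight B K≤B = trans (sumList-restrict (λ x → 𝟙s∣ x ℕ.* firstWeight/s x) K B K≤B) (trans (windowSum-multiples firstWeight/s s K)
      (trans (windowSum-cong (negℕ X) (suc (2 ℕ.* X)) firstWeight/s≡weight) (trans (windowSum-symmetric (λ y → weight P ℤ.∣ y ∣) X)
        (cong₂ ℕ._+_ (cong (ℕ._+ sumTo (weight P) X) w0) (sumTo-cong X (λ b → cong (weight P) (ℤP.∣-i∣≡∣i∣ (+ b))))))))
      where
      w0 : weight P 0 ≡ 0
      w0 = trans (weight-primeDivisors 0) (trans (cong (λ z → 𝟙 (d ND.∣? 0) ℕ.* (z ℕ.* 𝟙 (coprime? 0 s))) (𝟙-no (¬? (dd ND.∣? 0)) (λ f → f (ND.divides 0 refl)))) (ℕP.*-zeroʳ (𝟙 (d ND.∣? 0))))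


module ErrorPropagation where

  open RationalLemmas
  open import Defs
  open import Data.Nat as ℕ using (ℕ; suc; NonZero)
  open import Data.Rational using (ℚ; 0ℚ; 1ℚ; _+_; _*_; _-_; -_; _≤_; ∣_∣)
  import Data.Rational.Properties as ℚP
  open import Data.Rational.Solver using (module +-*-Solver)
  open import Relation.Binary.PropositionalEquality
  open +-*-Solver

  ∣[x^k-y^k]*z∣≤ : ∀ x y z M E k → 1ℚ ≤ M → 1ℚ ≤ E → ∣ x ∣ ≤ M → ∣ y ∣ ≤ M → ∣ x - y ∣ ≤ ℕtoℚ 2 → ∣ z ∣ ≤ M * M →
    ∣ (x ^ℚ k - y ^ℚ k) * z ∣ ≤ ℕtoℚ 2 * ℕtoℚ k * (M ^ℚ k * M) * E
  ∣[x^k-y^k]*z∣≤ x y z M E k 1≤M 1≤E hx hy hxy hz = ℚP.*-cancelˡ-≤-pos M {{1≤⇒positive 1≤M}} (begin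
      M * ∣ (x ^ℚ k - y ^ℚ k) * z ∣
    ≡⟨ cong (M *_) (ℚP.∣p*q∣≡∣p∣*∣q∣ (x ^ℚ k - y ^ℚ k) z) ⟩
      M * (∣ x ^ℚ k - y ^ℚ k ∣ * ∣ z ∣)
    ≡⟨ sym (ℚP.*-assoc M ∣ x ^ℚ k - y ^ℚ k ∣ ∣ z ∣) ⟩
      M * ∣ x ^ℚ k - y ^ℚ k ∣ * ∣ z ∣
    ≤⟨ *-mono (0≤* 0≤M (ℚP.0≤∣p∣ (x ^ℚ k - y ^ℚ k))) (ℚP.0≤∣p∣ z) (∣^-^∣≤ x y M k hx hy) hz ⟩
      ℕtoℚ k * ∣ x - y ∣ * M ^ℚ k * (M * M)
    ≤⟨ *-monoʳ (M * M) (0≤* 0≤M 0≤M) (*-monoʳ (M ^ℚ k) (0≤^ k 0≤M) (*-monoˡ (ℕtoℚ k) (ℕtoℚ-nonneg k) hxy)) ⟩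
      ℕtoℚ k * ℕtoℚ 2 * M ^ℚ k * (M * M)
    ≤⟨ subst (_≤ ℕtoℚ k * ℕtoℚ 2 * M ^ℚ k * (M * M) * E) (ℚP.*-identityʳ _) (*-monoˡ (ℕtoℚ k * ℕtoℚ 2 * M ^ℚ k * (M * M)) (0≤* (0≤* (0≤* (ℕtoℚ-nonneg k) (ℕtoℚ-nonneg 2)) (0≤^ k 0≤M)) (0≤* 0≤M 0≤M)) 1≤E) ⟩
      ℕtoℚ k * ℕtoℚ 2 * M ^ℚ k * (M * M) * E
    ≡⟨ solve 5 (λ K T P M E → K :* T :* P :* (M :* M) :* E := M :* (T :* K :* (P :* M) :* E)) refl (ℕtoℚ k) (ℕtoℚ 2) (M ^ℚ k) M E ⟩
      M * (ℕtoℚ 2 * ℕtoℚ k * (M ^ℚ k * M) * E)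
    ∎)
    where
    open ℚP.≤-Reasoning
    0≤M = 1≤⇒0≤ 1≤M

  product-error : ∀ (u M a v N SL ρ E : ℚ) k →
    0ℚ ≤ u → u ≤ M → 1ℚ ≤ M → 0ℚ ≤ v → ℕtoℚ 2 + v ≤ M →
    ∣ a - v ∣ ≤ ℕtoℚ 2 → 0ℚ ≤ N → ∣ N - u * ρ ∣ ≤ E → ∣ SL - N * v ∣ ≤ ℕtoℚ 2 * N →
    0ℚ ≤ ρ → ρ ≤ 1ℚ → 1ℚ ≤ E →
    ∣ a ^ℚ k * SL - v ^ℚ k * v * u * ρ ∣ ≤ ℕtoℚ (5 ℕ.+ 2 ℕ.* k) * M ^ℚ (suc k) * E
  product-error u M a v N SL ρ E k 0≤u u≤M 1≤M 0≤v v+2≤M ha 0≤N hN hSL 0≤ρ ρ≤1 1≤E = begin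
      ∣ a ^ℚ k * SL - v ^ℚ k * v * u * ρ ∣
    ≡⟨ cong ∣_∣ (solve 8 (λ A V v N SL u ρ e → A :* SL :- V :* v :* u :* ρ := A :* (SL :- N :* v) :+ (A :* v :* (N :- u :* ρ) :+ (A :- V) :* (v :* u :* ρ))) refl (a ^ℚ k) (v ^ℚ k) v N SL u ρ E) ⟩
      ∣ a ^ℚ k * (SL - N * v) + (a ^ℚ k * v * (N - u * ρ) + (a ^ℚ k - v ^ℚ k) * (v * u * ρ)) ∣
    ≤⟨ ℚP.≤-trans (ℚP.∣p+q∣≤∣p∣+∣q∣ (a ^ℚ k * (SL - N * v)) (a ^ℚ k * v * (N - u * ρ) + (a ^ℚ k - v ^ℚ k) * (v * u * ρ))) (ℚP.+-monoʳ-≤ ∣ a ^ℚ k * (SL - N * v) ∣ (ℚP.∣p+q∣≤∣p∣+∣q∣ (a ^ℚ k * v * (N - u * ρ)) ((a ^ℚ k - v ^ℚ k) * (v * u * ρ)))) ⟩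
      ∣ a ^ℚ k * (SL - N * v) ∣ + (∣ a ^ℚ k * v * (N - u * ρ) ∣ + ∣ (a ^ℚ k - v ^ℚ k) * (v * u * ρ) ∣)
    ≤⟨ ℚP.+-mono-≤ T1 (ℚP.+-mono-≤ T2 T3) ⟩
      Mk * (ℕtoℚ 4 * M * E) + (Mk * M * E + ℕtoℚ 2 * ℕtoℚ k * (Mk * M) * E)
    ≡⟨ solve 4 (λ P M E K → P :* (con (ℕtoℚ 4) :* M :* E) :+ (P :* M :* E :+ con (ℕtoℚ 2) :* K :* (P :* M) :* E) := (con (ℕtoℚ 5) :+ con (ℕtoℚ 2) :* K) :* (M :* P) :* E) refl Mk M E (ℕtoℚ k) ⟩
      (ℕtoℚ 5 + ℕtoℚ 2 * ℕtoℚ k) * (M * Mk) * E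
    ≡⟨ cong (λ z → z * (M * Mk) * E) (trans (cong (ℕtoℚ 5 +_) (sym (ℕtoℚ-* 2 k))) (sym (ℕtoℚ-+ 5 (2 ℕ.* k)))) ⟩
      ℕtoℚ (5 ℕ.+ 2 ℕ.* k) * M ^ℚ (suc k) * E
    ∎
    where
    open ℚP.≤-Reasoning
    Mk = M ^ℚ k
    0≤M = 1≤⇒0≤ 1≤M
    0≤E = 1≤⇒0≤ 1≤E
    v≤2v : v ≤ ℕtoℚ 2 + v
    v≤2v = subst (_≤ ℕtoℚ 2 + v) (ℚP.+-identityˡ v) (ℚP.+-monoˡ-≤ v (ℕtoℚ-mono {0} {2} ℕ.z≤n))
    av : ∣ a ∣ ≤ M
    av = ℚP.≤-trans (∣∣≤+∣∣ ha) (ℚP.≤-trans (ℚP.≤-reflexive (cong (ℕtoℚ 2 +_) (ℚP.0≤p⇒∣p∣≡p 0≤v))) v+2≤M)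
    vv : ∣ v ∣ ≤ M
    vv = subst (_≤ M) (sym (ℚP.0≤p⇒∣p∣≡p 0≤v)) (ℚP.≤-trans v≤2v v+2≤M)
    ak : ∣ a ^ℚ k ∣ ≤ Mk
    ak = ∣^∣≤ k av
    uρ≤M : u * ρ ≤ M
    uρ≤M = ℚP.≤-trans (*-monoˡ u 0≤u ρ≤1) (ℚP.≤-trans (ℚP.≤-reflexive (ℚP.*-identityʳ u)) u≤M)
    N≤ : N ≤ E + M
    N≤ = subst (_≤ E + M) (solve 2 (λ N x → (N :- x) :+ x := N) refl N (u * ρ)) (ℚP.+-mono-≤ (∣∣≤⇒≤ hN) uρ≤M)
    E≤ME : E ≤ M * E
    E≤ME = subst (_≤ M * E) (ℚP.*-identityˡ E) (*-monoʳ E 0≤E 1≤M)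
    M≤ME : M ≤ M * E
    M≤ME = subst (_≤ M * E) (ℚP.*-identityʳ M) (*-monoˡ M 0≤M 1≤E)
    2N≤ : ℕtoℚ 2 * N ≤ ℕtoℚ 4 * M * E
    2N≤ = ℚP.≤-trans (*-monoˡ (ℕtoℚ 2) (ℕtoℚ-nonneg 2) (ℚP.≤-trans N≤ (ℚP.+-mono-≤ E≤ME M≤ME)))
      (ℚP.≤-reflexive (solve 2 (λ M E → con (ℕtoℚ 2) :* (M :* E :+ M :* E) := con (ℕtoℚ 4) :* M :* E) refl M E))
    T1 : ∣ a ^ℚ k * (SL - N * v) ∣ ≤ Mk * (ℕtoℚ 4 * M * E)
    T1 = ∣*∣≤ ak (ℚP.≤-trans hSL 2N≤)
    T2 : ∣ a ^ℚ k * v * (N - u * ρ) ∣ ≤ Mk * M * E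
    T2 = ∣*∣≤ (∣*∣≤ ak vv) hN
    vuρ : ∣ v * u * ρ ∣ ≤ M * M
    vuρ = subst (_≤ M * M) (sym (ℚP.0≤p⇒∣p∣≡p (0≤* (0≤* 0≤v 0≤u) 0≤ρ))) (ℚP.≤-trans (ℚP.≤-reflexive (ℚP.*-assoc v u ρ)) (*-mono 0≤v (0≤* 0≤u 0≤ρ) (ℚP.≤-trans v≤2v v+2≤M) uρ≤M))
    T3 : ∣ (a ^ℚ k - v ^ℚ k) * (v * u * ρ) ∣ ≤ ℕtoℚ 2 * ℕtoℚ k * (Mk * M) * E
    T3 = ∣[x^k-y^k]*z∣≤ a v (v * u * ρ) M E k 1≤M 1≤E av vv ha vuρ

  windowCount-approx : ∀ x N n q .{{_ : NonZero q}} u → q ℕ.* x ℕ.≤ N ℕ.* (n ℕ.+ q) → N ℕ.* n ℕ.≤ q ℕ.* x ℕ.+ N ℕ.* q →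
    ∣ ℕtoℚ n - u ∣ ≤ 1ℚ → ∣ ℕtoℚ x - ℕtoℚ N * (u * recip q) ∣ ≤ ℕtoℚ 2 * ℕtoℚ N
  windowCount-approx x N n q u h1 h2 hn = ∣∣≤-intro lo up
    where
    Q = ℕtoℚ q
    Nq = ℕtoℚ N
    I = recip q
    0≤N = ℕtoℚ-nonneg N
    0≤I = recip-nonneg q
    QI : Q * I ≡ 1ℚ
    QI = trans (ℚP.*-comm Q I) (recip*n≡1 q)
    n≤ : ℕtoℚ n ≤ u + 1ℚ
    n≤ = subst (_≤ u + 1ℚ) (solve 2 (λ n u → (n :- u) :+ u := n) refl (ℕtoℚ n) u) (subst (ℕtoℚ n - u + u ≤_) (ℚP.+-comm 1ℚ u) (ℚP.+-monoˡ-≤ u (∣∣≤⇒≤ hn)))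
    n≥ : u - 1ℚ ≤ ℕtoℚ n
    n≥ = subst₂ _≤_ (solve 1 (λ u → :- con 1ℚ :+ u := u :- con 1ℚ) refl u) (solve 2 (λ n u → (n :- u) :+ u := n) refl (ℕtoℚ n) u) (ℚP.+-monoˡ-≤ u (∣∣≤⇒-≤ hn))
    xup : ℕtoℚ x ≤ Nq * (ℕtoℚ n + Q) * I
    xup = *n≤⇒≤*recip q (subst₂ _≤_ (trans (ℕtoℚ-* q x) (ℚP.*-comm Q (ℕtoℚ x))) (trans (ℕtoℚ-* N _) (cong (Nq *_) (ℕtoℚ-+ n q))) (ℕtoℚ-mono h1))
    xlo : Nq * ℕtoℚ n * I ≤ ℕtoℚ x + Nq
    xlo = ℚP.≤-trans (≤*n⇒*recip≤ q (subst₂ _≤_ (ℕtoℚ-* N n) (trans (ℕtoℚ-+ (q ℕ.* x) (N ℕ.* q)) (trans (cong₂ _+_ (ℕtoℚ-* q x) (ℕtoℚ-* N q)) (solve 3 (λ Q X N → Q :* X :+ N :* Q := (X :+ N) :* Q) refl Q (ℕtoℚ x) Nq))) (ℕtoℚ-mono h2))) ℚP.≤-refl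
    up : ℕtoℚ x - Nq * (u * I) ≤ ℕtoℚ 2 * Nq
    up = 0≤-⇒≤ (subst (0ℚ ≤_) eq (0≤+ (≤⇒0≤- xup) (0≤+ (0≤* (0≤* 0≤N 0≤I) (≤⇒0≤- n≤)) (0≤* 0≤N (≤⇒0≤- (recip≤1 q))))))
      where
      eq : Nq * (ℕtoℚ n + Q) * I - ℕtoℚ x + (Nq * I * (u + 1ℚ - ℕtoℚ n) + Nq * (1ℚ - I)) ≡ ℕtoℚ 2 * Nq - (ℕtoℚ x - Nq * (u * I))
      eq = trans (solve 7 (λ N n Q I x u T → N :* (n :+ Q) :* I :- x :+ (N :* I :* (u :+ con 1ℚ :- n) :+ N :* (con 1ℚ :- I)) := (con 1ℚ :+ con 1ℚ) :* N :- (x :- N :* (u :* I)) :+ N :* (Q :* I :- con 1ℚ)) refl Nq (ℕtoℚ n) Q I (ℕtoℚ x) u (ℕtoℚ 2))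
        (trans (cong (λ z → (1ℚ + 1ℚ) * Nq - (ℕtoℚ x - Nq * (u * I)) + Nq * (z - 1ℚ)) QI) (solve 3 (λ N x y → (con 1ℚ :+ con 1ℚ) :* N :- (x :- y) :+ N :* (con 1ℚ :- con 1ℚ) := con (ℕtoℚ 2) :* N :- (x :- y)) refl Nq (ℕtoℚ x) (Nq * (u * I))))
    lo : - (ℕtoℚ 2 * Nq) ≤ ℕtoℚ x - Nq * (u * I)
    lo = 0≤-⇒≤ (subst (0ℚ ≤_) eq (0≤+ (≤⇒0≤- xlo) (0≤+ (0≤* (0≤* 0≤N 0≤I) (≤⇒0≤- n≥)) (0≤* 0≤N (≤⇒0≤- (recip≤1 q))))))
      where
      eq : ℕtoℚ x + Nq - Nq * ℕtoℚ n * I + (Nq * I * (ℕtoℚ n - (u - 1ℚ)) + Nq * (1ℚ - I)) ≡ ℕtoℚ x - Nq * (u * I) - - (ℕtoℚ 2 * Nq)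
      eq = solve 6 (λ x N n I u T → x :+ N :- N :* n :* I :+ (N :* I :* (n :- (u :- con 1ℚ)) :+ N :* (con 1ℚ :- I)) := x :- N :* (u :* I) :- :- (con (ℕtoℚ 2) :* N)) refl (ℕtoℚ x) Nq (ℕtoℚ n) I u (ℕtoℚ 2)


module MainEstimate where

  open FiniteSums
  open RationalLemmas
  open RationalFloor
  open Sieve
  open SieveDensity
  open IntegerWindows
  open Coordinates
  open ErrorPropagation
  open import Defs
  open import Data.Nat as ℕ using (ℕ; suc; NonZero)
  import Data.Nat.Properties as ℕP
  open import Data.Nat.Tactic.RingSolver using (solve-∀)
  import Data.Nat.DivMod as DM
  open import Data.Nat.Coprimality using (Coprime; coprime?)
  open import Data.Nat.Primality using (Prime; prime⇒nonZero)
  open import Data.Integer as ℤ using (ℤ; +_)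
  import Data.Integer.Properties as ℤP
  import Data.Integer.Divisibility.Signed as ZD
  open import Data.Integer.Divisibility.Signed using (_∣?_)
  import Data.Integer.DivMod as ZDM
  open import Data.Integer.GCD using (gcd)
  open import Data.Rational as ℚ using (ℚ; 0ℚ; 1ℚ; _+_; _*_; _-_; -_; _≤_; ∣_∣)
  import Data.Rational.Properties as ℚP
  open import Data.Rational.Solver using (module +-*-Solver)
  open import Data.List using (List; map; upTo)
  import Data.List.Properties as LP
  open import Data.Product using (_×_; _,_; proj₁; proj₂)
  open import Data.Sum using (_⊎_; inj₁; inj₂)
  open import Function using (_∘_)
  open import Relation.Nullary using (yes; no)
  open import Relation.Nullary.Decidable using (¬?)
  open import Relation.Binary.PropositionalEquality

  open +-*-Solver

  φ≤n : ∀ n → φ n ℕ.≤ n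
  φ≤n n = ℕP.≤-trans (LP.length-filter (λ k → coprime? k n) (map suc (upTo n))) (ℕP.≤-reflexive (trans (LP.length-map suc (upTo n)) (LP.length-upTo n)))

  -- (5 + 2k) M^{k+1} ε with k = d - 2, M = 6H/s and ε ≤ 8 · 2^{ω(s)}; see product-error.
  errorConstant : ℕ → ℚ
  errorConstant m = ℕtoℚ ((5 ℕ.+ 2 ℕ.* suc m) ℕ.* 3 ℕ.^ suc (suc m) ℕ.* 2 ℕ.^ suc (suc m) ℕ.* 8)

  module Estimate (m : ℕ) (pd : Prime (suc (suc (suc m)))) (H : ℚ) (1≤H : 1ℚ ≤ H) (s : ℕ) .{{nzs : NonZero s}} (s≤H : ℕtoℚ s ≤ H) (s⊥d : Coprime s (suc (suc (suc m)))) where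
    open Floor (floor H 1≤H)
    open CoordinateWeights m s K
    open CoordinateSums m pd s s⊥d K
    open SieveWeight d pd using (weight; E)
    open TotientDensity d pd s s⊥d using (P; sumTo-weight-φ-approx; E≤3*2^ω; T)
    instance
      nzd : NonZero d
      nzd = prime⇒nonZero pd
      nzq : NonZero dd
      nzq = ℕP.m*n≢0 d d
    open MultiplesInWindow dd using (𝟙q∣; windowSum-bounds)

    B : ℕ
    B = ℤ.∣ ℚ.ceiling H ∣

    xs : List ℤ
    xs = intsUpTo B

    len : ℕ
    len = suc (2 ℕ.* X)

    A : ℕ
    A = sumList middleWeight xs

    lastCount : ℤ → ℕ
    lastCount a0 = sumList (lastWeight a0) xs

    S : ℕ
    S = sumList (λ a0 → firstWeight a0 ℕ.* lastCount a0) xs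

    N₀ : ℕ
    N₀ = sumList firstWeight xs

    sieved : ℕ
    sieved = sumTo (weight P) X

    countG'≡A^k*S : countG' d s H ≡ A ℕ.^ suc m ℕ.* S
    countG'≡A^k*S = countG'-factorisation H ≤H⇔≤K

    A-bounds : (dd ℕ.* A ℕ.≤ len ℕ.+ dd) × (len ℕ.≤ dd ℕ.* A ℕ.+ dd)
    A-bounds = subst (λ z → (dd ℕ.* z ℕ.≤ len ℕ.+ dd) × (len ℕ.≤ dd ℕ.* z ℕ.+ dd)) (sym (sum-middleWeight B K≤∣ceiling∣)) (windowSum-bounds (negℕ X) len)

    firstWeight-cases : ∀ x → firstWeight x ≡ 0 ⊎ (firstWeight x ≡ 1 × (+ s ZD.∣ x) × (+ d ZD.∣ x))
    firstWeight-cases x with ℤ.∣ x ∣ ℕP.≤? K | + s ∣? x | gcd (x ZDM./ + s) (+ s) ℤP.≟ + 1 | + d ∣? x | ¬? (+ dd ∣? x)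
    ... | yes _ | yes s∣x | yes _ | yes d∣x | yes _ = inj₂ (refl , s∣x , d∣x)
    ... | no _ | _ | _ | _ | _ = inj₁ refl
    ... | yes _ | no _ | _ | _ | _ = inj₁ refl
    ... | yes _ | yes _ | no _ | _ | _ = inj₁ refl
    ... | yes _ | yes _ | yes _ | no _ | _ = inj₁ refl
    ... | yes _ | yes _ | yes _ | yes _ | no _ = inj₁ refl

    bounds-*1 : ∀ Lv → dd ℕ.* Lv ℕ.≤ len ℕ.+ dd → len ℕ.≤ dd ℕ.* Lv ℕ.+ dd → (dd ℕ.* (1 ℕ.* Lv) ℕ.≤ 1 ℕ.* (len ℕ.+ dd)) × (1 ℕ.* len ℕ.≤ dd ℕ.* (1 ℕ.* Lv) ℕ.+ 1 ℕ.* dd)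
    bounds-*1 Lv h1 h2 rewrite ℕP.*-identityˡ Lv | ℕP.*-identityˡ (len ℕ.+ dd) | ℕP.*-identityˡ len | ℕP.*-identityˡ dd = h1 , h2

    firstWeight*lastCount-bounds : ∀ a0 → (dd ℕ.* (firstWeight a0 ℕ.* lastCount a0) ℕ.≤ firstWeight a0 ℕ.* (len ℕ.+ dd)) × (firstWeight a0 ℕ.* len ℕ.≤ dd ℕ.* (firstWeight a0 ℕ.* lastCount a0) ℕ.+ firstWeight a0 ℕ.* dd)
    firstWeight*lastCount-bounds a0 with firstWeight-cases a0
    ... | inj₁ e rewrite e = ℕP.≤-reflexive (ℕP.*-zeroʳ dd) , ℕ.z≤n
    ... | inj₂ (e , ZD.divides b0 refl , d∣b0*s) rewrite e =
          bounds-*1 (lastCount (b0 ℤ.* + s)) (subst (λ z → dd ℕ.* z ℕ.≤ len ℕ.+ dd) (sym LL) (proj₁ bb)) (subst (λ z → len ℕ.≤ dd ℕ.* z ℕ.+ dd) (sym LL) (proj₂ bb))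
      where
      bb = windowSum-bounds (b0 ℤ.+ negℕ X) len
      d∣b0 : + d ZD.∣ b0
      d∣b0 = 𝟙≡1⇒ (+ d ∣? b0) (trans (sym (𝟙-∣-*s d coprime-d-s b0)) (𝟙-yes (+ d ∣? (b0 ℤ.* + s)) d∣b0*s))
      LL : lastCount (b0 ℤ.* + s) ≡ windowSum 𝟙q∣ (b0 ℤ.+ negℕ X) len
      LL = sum-lastWeight B K≤∣ceiling∣ b0 d∣b0

    S-bounds : (dd ℕ.* S ℕ.≤ N₀ ℕ.* (len ℕ.+ dd)) × (N₀ ℕ.* len ℕ.≤ dd ℕ.* S ℕ.+ N₀ ℕ.* dd)
    S-bounds = subst₂ ℕ._≤_ (sumList-*ˡ dd (λ a0 → firstWeight a0 ℕ.* lastCount a0) xs) (sumList-*ʳ (len ℕ.+ dd) firstWeight xs) (sumList-mono xs (proj₁ ∘ firstWeight*lastCount-bounds)) ,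
            subst₂ ℕ._≤_ (sumList-*ʳ len firstWeight xs) (trans (sumList-+ (λ a0 → dd ℕ.* (firstWeight a0 ℕ.* lastCount a0)) (λ a0 → firstWeight a0 ℕ.* dd) xs) (cong₂ ℕ._+_ (sumList-*ˡ dd (λ a0 → firstWeight a0 ℕ.* lastCount a0) xs) (sumList-*ʳ dd firstWeight xs))) (sumList-mono xs (proj₂ ∘ firstWeight*lastCount-bounds))

    N₀≡2*sieved : N₀ ≡ sieved ℕ.+ sieved
    N₀≡2*sieved = sum-firstWeight B K≤∣ceiling∣

    -- h = H/s approximates X, u = 2h the window length 2X + 1, v = u/d² the middle count A
    -- and every nonzero last count, and u ρ the number N₀ of admissible a₀.
    h u v M ρ ε : ℚ
    h = H * recip s
    u = ℕtoℚ 2 * h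
    v = u * recip dd
    M = ℕtoℚ 3 * u
    ρ = ℕtoℚ (φ (d ℕ.* s)) * recip T
    ε = ℕtoℚ (2 ℕ.* E P ℕ.+ 2)

    X≤h : ℕtoℚ X ≤ h
    X≤h = *n≤⇒≤*recip s (subst (_≤ H) (ℕtoℚ-* X s) (proj₂ (≤H⇔≤K (X ℕ.* s)) (DM.m/n*n≤m K s)))

    suc-K≤suc-X*s : suc K ℕ.≤ suc X ℕ.* s
    suc-K≤suc-X*s = begin
        suc K ≡⟨ cong suc (DM.m≡m%n+[m/n]*n K s) ⟩
        suc (K DM.% s ℕ.+ X ℕ.* s) ≤⟨ ℕP.+-monoˡ-≤ (X ℕ.* s) (DM.m%n<n K s) ⟩
        s ℕ.+ X ℕ.* s ∎
      where open ℕP.≤-Reasoning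

    h≤X+1 : h ≤ ℕtoℚ X + 1ℚ
    h≤X+1 = ≤*n⇒*recip≤ s (ℚP.≤-trans H≤suc-K (ℚP.≤-trans (ℕtoℚ-mono suc-K≤suc-X*s) (ℚP.≤-reflexive (trans (ℕtoℚ-* (suc X) s) (cong (_* ℕtoℚ s) (trans (cong ℕtoℚ (ℕP.+-comm 1 X)) (ℕtoℚ-+ X 1)))))))

    1≤h : 1ℚ ≤ h
    1≤h = *n≤⇒≤*recip s (subst (_≤ H) (sym (ℚP.*-identityˡ (ℕtoℚ s))) s≤H)

    0≤h-X : 0ℚ ≤ h - ℕtoℚ X
    0≤h-X = ≤⇒0≤- X≤h

    h-X≤1 : h - ℕtoℚ X ≤ 1ℚ
    h-X≤1 = subst₂ _≤_ refl (solve 1 (λ x → x :+ con 1ℚ :- x := con 1ℚ) refl (ℕtoℚ X)) (ℚP.+-monoˡ-≤ (- ℕtoℚ X) h≤X+1)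

    ℕtoℚ-len : ℕtoℚ len ≡ ℕtoℚ 2 * ℕtoℚ X + 1ℚ
    ℕtoℚ-len = trans (cong ℕtoℚ (ℕP.+-comm 1 (2 ℕ.* X))) (trans (ℕtoℚ-+ (2 ℕ.* X) 1) (cong (_+ 1ℚ) (ℕtoℚ-* 2 X)))

    ∣len-u∣≤1 : ∣ ℕtoℚ len - u ∣ ≤ 1ℚ
    ∣len-u∣≤1 = subst (λ z → ∣ z ∣ ≤ 1ℚ) (sym e) (∣∣≤-intro lo up)
      where
      t = h - ℕtoℚ X
      e : ℕtoℚ len - u ≡ 1ℚ - ℕtoℚ 2 * t
      e = trans (cong (_- u) ℕtoℚ-len) (solve 3 (λ T x h → T :* x :+ con 1ℚ :- T :* h := con 1ℚ :- T :* (h :- x)) refl (ℕtoℚ 2) (ℕtoℚ X) h)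
      up : 1ℚ - ℕtoℚ 2 * t ≤ 1ℚ
      up = 0≤-⇒≤ (subst (0ℚ ≤_) (solve 2 (λ T t → T :* t := con 1ℚ :- (con 1ℚ :- T :* t)) refl (ℕtoℚ 2) t) (0≤* (ℕtoℚ-nonneg 2) 0≤h-X))
      lo : - 1ℚ ≤ 1ℚ - ℕtoℚ 2 * t
      lo = 0≤-⇒≤ (subst (0ℚ ≤_) (solve 1 (λ t → con (ℕtoℚ 2) :* (con 1ℚ :- t) := con 1ℚ :- con (ℕtoℚ 2) :* t :- :- con 1ℚ) refl t) (0≤* (ℕtoℚ-nonneg 2) (≤⇒0≤- h-X≤1)))
    instance
      nzT : NonZero T
      nzT = ℕP.m*n≢0 dd s

    0≤ρ : 0ℚ ≤ ρ
    0≤ρ = 0≤* (ℕtoℚ-nonneg (φ (d ℕ.* s))) (recip-nonneg T)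

    ρ≤1 : ρ ≤ 1ℚ
    ρ≤1 = ≤*n⇒*recip≤ T (subst (ℕtoℚ (φ (d ℕ.* s)) ≤_) (sym (ℚP.*-identityˡ (ℕtoℚ T))) (ℕtoℚ-mono (ℕP.≤-trans (φ≤n (d ℕ.* s)) ds≤T)))
      where
      ds≤T : d ℕ.* s ℕ.≤ T
      ds≤T = subst (d ℕ.* s ℕ.≤_) (sym (ℕP.*-assoc d d s)) (ℕP.m≤n*m (d ℕ.* s) d)

    ∣N₀-uρ∣≤ε : ∣ ℕtoℚ N₀ - u * ρ ∣ ≤ ε
    ∣N₀-uρ∣≤ε = subst (λ z → ∣ z ∣ ≤ ε) (sym e) (subst (∣ a - (- a) + c ∣ ≤_) (sym eE) (triangle₃ a (- a) c (sumTo-weight-φ-approx X) (∣-p∣≤ (sumTo-weight-φ-approx X)) cb))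
      where
      a = ℕtoℚ sieved - ℕtoℚ X * ρ
      t = h - ℕtoℚ X
      c = - (ℕtoℚ 2 * t * ρ)
      e : ℕtoℚ N₀ - u * ρ ≡ a - (- a) + c
      e = trans (cong (λ z → ℕtoℚ z - u * ρ) N₀≡2*sieved) (trans (cong (_- u * ρ) (ℕtoℚ-+ sieved sieved))
        (solve 4 (λ N x r h → N :+ N :- con (ℕtoℚ 2) :* h :* r := (N :- x :* r) :- (:- (N :- x :* r)) :+ (:- (con (ℕtoℚ 2) :* (h :- x) :* r))) refl (ℕtoℚ sieved) (ℕtoℚ X) ρ h))
      cb : ∣ c ∣ ≤ ℕtoℚ 2
      cb = ∣-p∣≤ (subst (_≤ ℕtoℚ 2) (sym (ℚP.0≤p⇒∣p∣≡p (0≤* (0≤* (ℕtoℚ-nonneg 2) 0≤h-X) 0≤ρ)))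
        (ℚP.≤-trans (*-mono (0≤* (ℕtoℚ-nonneg 2) 0≤h-X) 0≤ρ (*-monoˡ (ℕtoℚ 2) (ℕtoℚ-nonneg 2) h-X≤1) ρ≤1) (ℚP.≤-reflexive (solve 0 (con (ℕtoℚ 2) :* con 1ℚ :* con 1ℚ := con (ℕtoℚ 2)) refl))))
      eE : ε ≡ ℕtoℚ (E P) + ℕtoℚ (E P) + ℕtoℚ 2
      eE = trans (ℕtoℚ-+ (2 ℕ.* E P) 2) (cong (_+ ℕtoℚ 2) (trans (cong ℕtoℚ (cong (E P ℕ.+_) (ℕP.+-identityʳ (E P)))) (ℕtoℚ-+ (E P) (E P))))
    k : ℕ
    k = suc m

    ∣A-v∣≤2 : ∣ ℕtoℚ A - v ∣ ≤ ℕtoℚ 2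
    ∣A-v∣≤2 = subst₂ (λ a b → ∣ ℕtoℚ A - a ∣ ≤ b) (ℚP.*-identityˡ v) (ℚP.*-identityʳ (ℕtoℚ 2))
      (windowCount-approx A 1 len dd u (subst (dd ℕ.* A ℕ.≤_) (sym (ℕP.*-identityˡ (len ℕ.+ dd))) (proj₁ A-bounds))
         (subst₂ ℕ._≤_ (sym (ℕP.*-identityˡ len)) (cong (dd ℕ.* A ℕ.+_) (sym (ℕP.*-identityˡ dd))) (proj₂ A-bounds)) ∣len-u∣≤1)

    ∣S-N₀v∣≤2N₀ : ∣ ℕtoℚ S - ℕtoℚ N₀ * v ∣ ≤ ℕtoℚ 2 * ℕtoℚ N₀
    ∣S-N₀v∣≤2N₀ = windowCount-approx S N₀ len dd u (proj₁ S-bounds) (proj₂ S-bounds) ∣len-u∣≤1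

    0≤h : 0ℚ ≤ h
    0≤h = 1≤⇒0≤ 1≤h

    0≤u : 0ℚ ≤ u
    0≤u = 0≤* (ℕtoℚ-nonneg 2) 0≤h

    2≤u : ℕtoℚ 2 ≤ u
    2≤u = subst (_≤ u) (ℚP.*-identityʳ (ℕtoℚ 2)) (*-monoˡ (ℕtoℚ 2) (ℕtoℚ-nonneg 2) 1≤h)

    u≤M : u ≤ M
    u≤M = 0≤-⇒≤ (subst (0ℚ ≤_) (solve 1 (λ u → u :+ u := con (ℕtoℚ 3) :* u :- u) refl u) (0≤+ 0≤u 0≤u))

    1≤M : 1ℚ ≤ M
    1≤M = ℚP.≤-trans (ℚP.≤-trans (ℕtoℚ-mono {1} {2} (ℕ.s≤s ℕ.z≤n)) 2≤u) u≤M

    0≤v : 0ℚ ≤ v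
    0≤v = 0≤* 0≤u (recip-nonneg dd)

    v≤u : v ≤ u
    v≤u = subst (v ≤_) (ℚP.*-identityʳ u) (*-monoˡ u 0≤u (recip≤1 dd))

    2+v≤M : ℕtoℚ 2 + v ≤ M
    2+v≤M = ℚP.≤-trans (ℚP.+-mono-≤ 2≤u v≤u) (0≤-⇒≤ (subst (0ℚ ≤_) (solve 1 (λ u → u := con (ℕtoℚ 3) :* u :- (u :+ u)) refl u) 0≤u))

    1≤ε : 1ℚ ≤ ε
    1≤ε = ℕtoℚ-mono {1} {2 ℕ.* E P ℕ.+ 2} (ℕP.≤-trans (ℕ.s≤s ℕ.z≤n) (ℕP.m≤n+m 2 (2 ℕ.* E P)))

    main-bound : ∣ ℕtoℚ A ^ℚ k * ℕtoℚ S - v ^ℚ k * v * u * ρ ∣ ≤ ℕtoℚ (5 ℕ.+ 2 ℕ.* k) * M ^ℚ (suc k) * ε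
    main-bound = product-error u M (ℕtoℚ A) v (ℕtoℚ N₀) (ℕtoℚ S) ρ ε k 0≤u u≤M 1≤M 0≤v 2+v≤M ∣A-v∣≤2 (ℕtoℚ-nonneg N₀) ∣N₀-uρ∣≤ε ∣S-N₀v∣≤2N₀ 0≤ρ ρ≤1 1≤ε

    ℕtoℚ-countG' : ℕtoℚ (countG' d s H) ≡ ℕtoℚ A ^ℚ k * ℕtoℚ S
    ℕtoℚ-countG' = trans (cong ℕtoℚ countG'≡A^k*S) (trans (ℕtoℚ-* (A ℕ.^ k) S) (cong (_* ℕtoℚ S) (ℕtoℚ-^ A k)))

    mainTerm≡ : mainTerm d s H ≡ v ^ℚ k * v * u * ρ
    mainTerm≡ = begin
        mainTerm d s H
      ≡⟨ ÷ℕ≡*recip _ (s ℕ.^ (d ℕ.+ 1) ℕ.* d ℕ.^ (2 ℕ.* d)) ⟩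
        ℕtoℚ (2 ℕ.^ d) * H ^ℚ d * F * recip (s ℕ.^ (d ℕ.+ 1) ℕ.* d ℕ.^ (2 ℕ.* d))
      ≡⟨ cong₂ (λ a b → a * H ^ℚ d * F * b) (ℕtoℚ-^ 2 d) (trans (recip-* (s ℕ.^ (d ℕ.+ 1)) (d ℕ.^ (2 ℕ.* d)) {{ℕP.m^n≢0 s (d ℕ.+ 1)}} {{ℕP.m^n≢0 d (2 ℕ.* d)}}) (cong₂ _*_ (recip-^ s (d ℕ.+ 1)) (recip-^ d (2 ℕ.* d)))) ⟩
        t ^ℚ d * H ^ℚ d * F * (i ^ℚ (d ℕ.+ 1) * j ^ℚ (2 ℕ.* d))
      ≡⟨ cong₂ (λ a b → t ^ℚ d * H ^ℚ d * F * (a * b)) si dj ⟩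
        t ^ℚ d * H ^ℚ d * F * (i * (i * (i * (i ^ℚ m * i))) * ((j * (j * j ^ℚ k)) * (j * (j * j ^ℚ k))))
      ≡⟨ solve 9 (λ t P h Hk i Im j Jk F →
            (t :* (t :* P)) :* (h :* (h :* Hk)) :* F :* (i :* (i :* (i :* (Im :* i))) :* ((j :* (j :* Jk)) :* (j :* (j :* Jk))))
            := (P :* (Hk :* (i :* Im)) :* (Jk :* Jk)) :* (t :* (h :* i) :* (j :* j)) :* (t :* (h :* i)) :* (F :* (j :* j :* i)))
          refl t (t ^ℚ k) H (H ^ℚ k) i (i ^ℚ m) j (j ^ℚ k) F ⟩
        (t ^ℚ k * (H ^ℚ k * i ^ℚ k) * (j ^ℚ k * j ^ℚ k)) * x * (t * (H * i)) * (F * (j * j * i))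
      ≡⟨ cong (λ z → z * x * (t * (H * i)) * (F * (j * j * i))) (sym (trans (*-^ (t * (H * i)) (j * j) k) (cong₂ _*_ (trans (*-^ t (H * i) k) (cong (t ^ℚ k *_) (*-^ H i k))) (*-^ j j k)))) ⟩
        x ^ℚ k * x * (t * (H * i)) * (F * (j * j * i))
      ≡⟨ cong₂ (λ a b → a ^ℚ k * a * (t * (H * i)) * (F * b)) (sym vx) (sym (trans (recip-* dd s) (cong (_* i) (recip-* d d)))) ⟩
        v ^ℚ k * v * u * ρ
      ∎
      where
      open ≡-Reasoning
      t = ℕtoℚ 2
      F = ℕtoℚ (φ (d ℕ.* s))
      i = recip s
      j = recip d
      x = t * (H * i) * (j * j)
      vx : v ≡ x
      vx = trans (cong (u *_) (recip-* d d)) (cong (_* (j * j)) (refl {x = t * (H * i)}))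
      si : i ^ℚ (d ℕ.+ 1) ≡ i * (i * (i * (i ^ℚ m * i)))
      si = cong (λ z → i * (i * (i * z))) (trans (^-+ i m 1) (cong (i ^ℚ m *_) (ℚP.*-identityʳ i)))
      dj : j ^ℚ (2 ℕ.* d) ≡ (j * (j * j ^ℚ k)) * (j * (j * j ^ℚ k))
      dj = trans (^-+ j d (d ℕ.+ 0)) (cong ((j * (j * j ^ℚ k)) *_) (cong (j ^ℚ_) (ℕP.+-identityʳ d)))

    ε≤8*2^ω : ε ≤ ℕtoℚ 8 * ℕtoℚ (2 ℕ.^ ω s)
    ε≤8*2^ω = subst (ε ≤_) (ℕtoℚ-* 8 (2 ℕ.^ ω s)) (ℕtoℚ-mono (begin
        2 ℕ.* E P ℕ.+ 2 ≤⟨ ℕP.+-mono-≤ (ℕP.*-monoʳ-≤ 2 E≤3*2^ω) (ℕP.*-monoʳ-≤ 2 1≤W) ⟩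
        2 ℕ.* (3 ℕ.* W) ℕ.+ 2 ℕ.* W ≡⟨ solve-∀′ W ⟩
        8 ℕ.* W ∎))
      where
      open ℕP.≤-Reasoning
      W = 2 ℕ.^ ω s
      solve-∀′ : ∀ W → 2 ℕ.* (3 ℕ.* W) ℕ.+ 2 ℕ.* W ≡ 8 ℕ.* W
      solve-∀′ = solve-∀
      1≤W : 1 ℕ.≤ W
      1≤W = ℕ.>-nonZero⁻¹ W {{ℕP.m^n≢0 2 (ω s)}}

    bound≤errorConstant*errorTerm : ℕtoℚ (5 ℕ.+ 2 ℕ.* k) * M ^ℚ (suc k) * ε ≤ errorConstant m * errorTerm d s H
    bound≤errorConstant*errorTerm = ℚP.≤-trans (*-monoˡ (ℕtoℚ (5 ℕ.+ 2 ℕ.* k) * M ^ℚ (suc k)) (0≤* (ℕtoℚ-nonneg (5 ℕ.+ 2 ℕ.* k)) (0≤^ (suc k) (1≤⇒0≤ 1≤M))) ε≤8*2^ω) (ℚP.≤-reflexive e)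
      where
      open ≡-Reasoning
      i = recip s
      W = ℕtoℚ (2 ℕ.^ ω s)
      c5 = ℕtoℚ (5 ℕ.+ 2 ℕ.* k)
      e : c5 * M ^ℚ (suc k) * (ℕtoℚ 8 * W) ≡ errorConstant m * errorTerm d s H
      e = begin
          c5 * M ^ℚ (suc k) * (ℕtoℚ 8 * W)
        ≡⟨ cong (λ z → c5 * z * (ℕtoℚ 8 * W)) (trans (*-^ (ℕtoℚ 3) u (suc k)) (cong (ℕtoℚ 3 ^ℚ suc k *_) (trans (*-^ (ℕtoℚ 2) h (suc k)) (cong (ℕtoℚ 2 ^ℚ suc k *_) (*-^ H i (suc k)))))) ⟩
          c5 * (ℕtoℚ 3 ^ℚ suc k * (ℕtoℚ 2 ^ℚ suc k * (H ^ℚ suc k * i ^ℚ suc k))) * (ℕtoℚ 8 * W)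
        ≡⟨ solve 7 (λ c a b p q e w → c :* (a :* (b :* (p :* q))) :* (e :* w) := c :* a :* b :* e :* (p :* w :* q)) refl c5 (ℕtoℚ 3 ^ℚ suc k) (ℕtoℚ 2 ^ℚ suc k) (H ^ℚ suc k) (i ^ℚ suc k) (ℕtoℚ 8) W ⟩
          c5 * ℕtoℚ 3 ^ℚ suc k * ℕtoℚ 2 ^ℚ suc k * ℕtoℚ 8 * (H ^ℚ suc k * W * i ^ℚ suc k)
        ≡⟨ cong₂ _*_ (sym (trans (ℕtoℚ-* ((5 ℕ.+ 2 ℕ.* k) ℕ.* 3 ℕ.^ suc k ℕ.* 2 ℕ.^ suc k) 8) (cong (_* ℕtoℚ 8) (trans (ℕtoℚ-* ((5 ℕ.+ 2 ℕ.* k) ℕ.* 3 ℕ.^ suc k) (2 ℕ.^ suc k)) (cong₂ _*_ (trans (ℕtoℚ-* (5 ℕ.+ 2 ℕ.* k) (3 ℕ.^ suc k)) (cong (c5 *_) (ℕtoℚ-^ 3 (suc k)))) (ℕtoℚ-^ 2 (suc k)))))))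
             (sym (trans (÷ℕ≡*recip (H ^ℚ suc k * W) (s ℕ.^ suc k)) (cong (H ^ℚ suc k * W *_) (recip-^ s (suc k))))) ⟩
          errorConstant m * errorTerm d s H
        ∎

    countG'-estimate : ∣ ℕtoℚ (countG' d s H) - mainTerm d s H ∣ ≤ errorConstant m * errorTerm d s H
    countG'-estimate = begin
        ∣ ℕtoℚ (countG' d s H) - mainTerm d s H ∣   ≡⟨ cong₂ (λ a b → ∣ a - b ∣) ℕtoℚ-countG' mainTerm≡ ⟩
        ∣ ℕtoℚ A ^ℚ k * ℕtoℚ S - v ^ℚ k * v * u * ρ ∣ ≤⟨ main-bound ⟩
        ℕtoℚ (5 ℕ.+ 2 ℕ.* k) * M ^ℚ suc k * ε         ≤⟨ bound≤errorConstant*errorTerm ⟩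
        errorConstant m * errorTerm d s H           ∎
      where open ℚP.≤-Reasoning


lemma3 : (d : ℕ) → Prime d → ¬ (2 ∣ d) →
    ∃[ C ] ((H : ℚ) → 1ℚ ℚ.≤ H →
    (s : ℕ) .{{_ : NonZero s}} → ℕtoℚ s ℚ.≤ H → Coprime s d →
    ℚ.∣ ℕtoℚ (countG' d s H) ℚ.- mainTerm d s H ∣ ℚ.≤ C ℚ.* errorTerm d s H)
lemma3 0 0-prime _ = contradiction 0-prime ¬prime[0]
lemma3 1 1-prime _ = contradiction 1-prime ¬prime[1]
lemma3 2 _ 2∤2 = contradiction ∣-refl 2∤2
lemma3 (suc (suc (suc m))) d-prime _ =
  MainEstimate.errorConstant m , λ H 1≤H s s≤H s⊥d → MainEstimate.Estimate.countG'-estimate m d-prime H 1≤H s s≤H s⊥d
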